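{- Let $k \ge 1$ be an integer, and let $G$ be a graph on $n$ vertices. If $\beta^k(G) \ge 1$, then $G$ contains at least $k-1$ pairwise edge-disjoint perfect matchings if $n$ is even, or $k-1$ pairwise edge-disjoint near-perfect matchings if $n$ is odd.
   Context: All graphs are finite and simple. For $S\subseteq V(G)$, $\Lambda^k_G(S)$ is the set of vertices with at least $k$ neighbors in $S$, and $\beta^k(G)=\min\{|\Lambda^k_G(S)|/|S| : S\subseteq V(G),\ |S|\ge k,\ \Lambda^k_G(S)\ne V(G)\}$, with $\beta^k(G)=0$ if $|V(G)|<k$. A near-perfect matching of a graph of odd order is a matching covering all vertices but one. -}

module Defs where

open import Data.Nat using (ℕ; _≤_; _<_; _∸_; _≤ᵇ_; _%_)
open import Data.Bool using (Bool; true; false)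
open import Data.Fin using (Fin)
open import Data.Fin.Subset using (Subset; ∣_∣; _∩_; _∈_)
open import Data.Vec using (tabulate)
open import Data.Product using (Σ; ∃; _×_)
open import Relation.Binary.PropositionalEquality using (_≡_; _≢_)
open import Relation.Nullary using (¬_)

record Graph (n : ℕ) : Set where
  field
    adj   : Fin n → Fin n → Bool
    sym   : ∀ u v → adj u v ≡ adj v u
    irrefl : ∀ v → adj v v ≡ false

open Graph public

N : ∀ {n} → Graph n → Fin n → Subset n
N G v = tabulate (adj G v)

Λ : ∀ {n} → ℕ → Graph n → Subset n → Subset n
Λ k G S = tabulate (λ v → k ≤ᵇ ∣ N G v ∩ S ∣)

-- "1 ≤ β^k(G)".  β^k(G) = 0 if n < k; otherwise it is the minimum of
-- |Λ^k(S)|/|S| over S with |S| ≥ k and Λ^k(S) ≠ V (this set of S is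
-- nonempty when n ≥ k ≥ 1).  Hence 1 ≤ β^k(G) unfolds to: n ≥ k and
-- every such S satisfies |S| ≤ |Λ^k(S)|.
OneLeβ : ∀ {n} → ℕ → Graph n → Set
OneLeβ {n} k G =
  k ≤ n ×
  (∀ (S : Subset n) → k ≤ ∣ S ∣ → ¬ (∀ v → v ∈ Λ k G S) → ∣ S ∣ ≤ ∣ Λ k G S ∣)

EdgeSet : ℕ → Set
EdgeSet n = Fin n → Fin n → Bool

record IsMatching {n} (G : Graph n) (M : EdgeSet n) : Set where
  field
    inG  : ∀ u v → M u v ≡ true → adj G u v ≡ true
    symm : ∀ u v → M u v ≡ M v u
    atMostOne : ∀ u v w → M u v ≡ true → M u w ≡ true → v ≡ w

Covered : ∀ {n} → EdgeSet n → Fin n → Set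
Covered M v = ∃ λ u → M v u ≡ true

IsPerfectMatching : ∀ {n} → Graph n → EdgeSet n → Set
IsPerfectMatching G M = IsMatching G M × (∀ v → Covered M v)

IsNearPerfectMatching : ∀ {n} → Graph n → EdgeSet n → Set
IsNearPerfectMatching G M =
  IsMatching G M × (∃ λ x → ¬ Covered M x × (∀ v → v ≢ x → Covered M v))

PairwiseEdgeDisjoint : ∀ {n m} → (Fin m → EdgeSet n) → Set
PairwiseEdgeDisjoint {n} {m} Ms =
  ∀ (i j : Fin m) → i ≢ j → ∀ u v → ¬ (Ms i u v ≡ true × Ms j u v ≡ true)

-- The matchings are chosen greedily.  If F is the union of those already
-- chosen, F has maximum degree at most k − 2, and a perfect matching of G − F
-- (of G − F plus a universal vertex when n is odd) gives the next one.  It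
-- exists by Lovász's proof of Tutte's theorem unless some supergraph of G − F
-- contains the configuration that proof finds in an edge-maximal graph without
-- a perfect matching: sets C ⊆ S of non-universal vertices, with |C| + |U| < |S|
-- for the set U of universal vertices, such that every vertex outside C ∪ U has
-- at most one neighbour in S, and some x₀ ∈ C has all its neighbours in C ∪ U.
-- Back in G, vertices outside C ∪ U have at most k − 1 neighbours in S, so
-- Λ^k(S) ⊆ C ∪ U is smaller than S; and |S| ≥ k, because β^k(G) ≥ 1 forces
-- x₀ to have degree at least 2k − 1 while its neighbours lie in F ∪ C ∪ U.
-- This contradicts β^k(G) ≥ 1.

module Submission where

open import Data.Bool using (Bool; true; false; _∧_; _∨_; not; if_then_else_)
open import Data.Bool.Properties
  using (∧-conicalˡ; ∧-conicalʳ; ∧-identityʳ; ∨-zeroʳ; ∨-comm; ∧-comm; not-¬; ¬-not; not-injective; T-≡)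
  renaming (_≟_ to _≟ᴮ_)
open import Data.Empty using (⊥; ⊥-elim)
open import Data.Fin using (Fin; zero; suc; toℕ)
open import Data.Fin.Permutation using (permutation)
open import Data.Fin.Permutation.Components using (transpose)
open import Data.Fin.Properties using (_≟_; suc-injective; pigeonhole; all?; any?; ¬∀⟶∃¬)
open import Data.Fin.Subset using (∣_∣; _∩_; _∈_)
open import Data.Nat using (ℕ; zero; suc; _+_; _∸_; _≤_; _<_; _≤ᵇ_; _%_; z≤n; s≤s)
open import Data.Nat.Induction using (<-wellFounded)
open import Data.Nat.Properties hiding (suc-injective) renaming (_≟_ to _≟ℕ_)
open import Data.Product using (Σ; ∃; _×_; _,_; proj₁; proj₂)
open import Data.Sum using (_⊎_; inj₁; inj₂; map₂)
open import Data.Vec using (_∷_; tabulate)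
open import Data.Vec.Properties using (tabulate-cong; lookup∘tabulate; []=⇒lookup)
open import Function using (_∘_; id; mk⇔; Equivalence)
open import Induction.WellFounded using (Acc; acc)
open import Relation.Binary.PropositionalEquality
open import Relation.Nullary using (¬_; ¬?; Dec; yes; no; does; contradiction)
open import Relation.Nullary.Decidable using (dec-true; dec-false; does-⇔; _⊎-dec_; _×-dec_)

open import Defs renaming (sym to adj-sym; irrefl to adj-irrefl)
open import Algebra.Properties.CommutativeMonoid.Sum +-0-commutativeMonoid
  using (sum; ∑-distrib-+; sum-permute; sum-cong-≗)

-- Booleans and counting

∨-true⁻ : ∀ a {b} → a ∨ b ≡ true → a ≡ true ⊎ b ≡ true
∨-true⁻ true  _ = inj₁ refl
∨-true⁻ false p = inj₂ p

∨-trueʳ : ∀ a {b} → b ≡ true → a ∨ b ≡ true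
∨-trueʳ a p = trans (cong (a ∨_) p) (∨-zeroʳ a)

true-or-false : ∀ b → b ≡ true ⊎ b ≡ false
true-or-false true  = inj₁ refl
true-or-false false = inj₂ refl

_==_ : ∀ {n} → Fin n → Fin n → Bool
x == y = does (x ≟ y)

does⇒ : ∀ {A : Set} (a? : Dec A) → does a? ≡ true → A
does⇒ (yes a) _ = a

¬does⇒ : ∀ {A : Set} (a? : Dec A) → does a? ≡ false → ¬ A
¬does⇒ (no ¬a) _ = ¬a

==⇒≡ : ∀ {n} {x y : Fin n} → x == y ≡ true → x ≡ y
==⇒≡ {x = x} {y} = does⇒ (x ≟ y)

==-refl : ∀ {n} (x : Fin n) → x == x ≡ true
==-refl x = dec-true (x ≟ x) refl

bool→ℕ : Bool → ℕ
bool→ℕ true  = 1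
bool→ℕ false = 0

count : ∀ {n} → (Fin n → Bool) → ℕ
count f = sum (bool→ℕ ∘ f)

_⊆ᵇ_ : ∀ {n} → (Fin n → Bool) → (Fin n → Bool) → Set
f ⊆ᵇ g = ∀ x → f x ≡ true → g x ≡ true

sum-mono-≤ : ∀ {n} {f g : Fin n → ℕ} → (∀ i → f i ≤ g i) → sum f ≤ sum g
sum-mono-≤ {zero}  f≤g = z≤n
sum-mono-≤ {suc n} f≤g = +-mono-≤ (f≤g zero) (sum-mono-≤ (f≤g ∘ suc))

sum-mono-< : ∀ {n} {f g : Fin n → ℕ} → (∀ i → f i ≤ g i) → ∀ j → f j < g j → sum f < sum g
sum-mono-< f≤g zero    fj<gj = +-mono-<-≤ fj<gj (sum-mono-≤ (f≤g ∘ suc))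
sum-mono-< f≤g (suc j) fj<gj = +-mono-≤-< (f≤g zero) (sum-mono-< (f≤g ∘ suc) j fj<gj)

bool→ℕ-mono : ∀ {a b} → (a ≡ true → b ≡ true) → bool→ℕ a ≤ bool→ℕ b
bool→ℕ-mono {false} a⇒b = z≤n
bool→ℕ-mono {true}  a⇒b rewrite a⇒b refl = ≤-refl

count-cong : ∀ {n} {f g : Fin n → Bool} → (∀ x → f x ≡ g x) → count f ≡ count g
count-cong f≗g = sum-cong-≗ (cong bool→ℕ ∘ f≗g)

count-mono : ∀ {n} {f g : Fin n → Bool} → f ⊆ᵇ g → count f ≤ count g
count-mono f⊆g = sum-mono-≤ (bool→ℕ-mono ∘ f⊆g)

count-mono-< : ∀ {n} {f g : Fin n → Bool} → f ⊆ᵇ g → ∀ x → f x ≡ false → g x ≡ true → count f < count g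
count-mono-< f⊆g x fx gx = sum-mono-< (bool→ℕ-mono ∘ f⊆g) x (subst₂ (λ a b → bool→ℕ a < bool→ℕ b) (sym fx) (sym gx) ≤-refl)

count-∨-≤ : ∀ {n} (f g : Fin n → Bool) → count (λ x → f x ∨ g x) ≤ count f + count g
count-∨-≤ f g = ≤-trans (sum-mono-≤ (λ x → bool→ℕ-∨ (f x) (g x))) (≤-reflexive (∑-distrib-+ (bool→ℕ ∘ f) (bool→ℕ ∘ g)))
  where
  bool→ℕ-∨ : ∀ a b → bool→ℕ (a ∨ b) ≤ bool→ℕ a + bool→ℕ b
  bool→ℕ-∨ true  b = s≤s z≤n
  bool→ℕ-∨ false b = ≤-refl

count-∨-disjoint : ∀ {n} (f g : Fin n → Bool) → (∀ x → f x ≡ true → g x ≡ true → ⊥) →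
  count (λ x → f x ∨ g x) ≡ count f + count g
count-∨-disjoint f g disjoint =
  trans (sum-cong-≗ (λ x → bool→ℕ-∨ (f x) (g x) (disjoint x))) (∑-distrib-+ (bool→ℕ ∘ f) (bool→ℕ ∘ g))
  where
  bool→ℕ-∨ : ∀ a b → (a ≡ true → b ≡ true → ⊥) → bool→ℕ (a ∨ b) ≡ bool→ℕ a + bool→ℕ b
  bool→ℕ-∨ true  true  ¬both = ⊥-elim (¬both refl refl)
  bool→ℕ-∨ true  false ¬both = refl
  bool→ℕ-∨ false b     ¬both = refl

count-split : ∀ {n} (f g : Fin n → Bool) → count f ≡ count (λ x → f x ∧ g x) + count (λ x → f x ∧ not (g x))
count-split f g = trans (sum-cong-≗ (λ x → bool→ℕ-split (f x) (g x)))
                        (∑-distrib-+ (λ x → bool→ℕ (f x ∧ g x)) (λ x → bool→ℕ (f x ∧ not (g x))))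
  where
  bool→ℕ-split : ∀ a b → bool→ℕ a ≡ bool→ℕ (a ∧ b) + bool→ℕ (a ∧ not b)
  bool→ℕ-split true  true  = refl
  bool→ℕ-split true  false = refl
  bool→ℕ-split false b     = refl

count-false : ∀ {n} (f : Fin n → Bool) → (∀ x → f x ≡ false) → count f ≡ 0
count-false {zero}  f f≡false = refl
count-false {suc n} f f≡false rewrite f≡false zero = count-false (f ∘ suc) (f≡false ∘ suc)

count-true : ∀ n → count {n} (λ _ → true) ≡ n
count-true zero    = refl
count-true (suc n) = cong suc (count-true n)

count-singleton : ∀ {n} (y : Fin n) → count (_== y) ≡ 1
count-singleton {suc n} zero    = cong suc (count-false {n} (λ _ → false) (λ _ → refl))
count-singleton {suc n} (suc y) = count-singleton y

count-≤1 : ∀ {n} (f : Fin n → Bool) → (∀ x y → f x ≡ true → f y ≡ true → x ≡ y) → count f ≤ 1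
count-≤1 {zero}  f unique = z≤n
count-≤1 {suc n} f unique with f zero in f0
... | true  = ≤-reflexive (cong suc (count-false (f ∘ suc) λ x → ¬-not (λ fx → 0≢suc (unique zero (suc x) f0 fx))))
  where
  0≢suc : ∀ {x : Fin n} → zero ≢ suc x
  0≢suc ()
... | false = count-≤1 (f ∘ suc) (λ x y fx fy → suc-injective (unique (suc x) (suc y) fx fy))

count-remove : ∀ {n} (f : Fin n → Bool) x → f x ≡ true → count f ≡ suc (count (λ y → f y ∧ not (y == x)))
count-remove f x fx = trans (count-split f (_== x)) (cong (_+ count (λ y → f y ∧ not (y == x))) (trans (count-cong at-x) (count-singleton x)))
  where
  at-x : ∀ y → f y ∧ (y == x) ≡ (y == x)
  at-x y with y ≟ x
  ... | yes refl = trans (∧-comm (f y) true) fx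
  ... | no  _    = ∧-comm (f y) false

count-involution : ∀ {n} (f : Fin n → Bool) (σ : Fin n → Fin n) → (∀ x → σ (σ x) ≡ x) → count f ≡ count (f ∘ σ)
count-involution f σ σσ = sum-permute (bool→ℕ ∘ f) (permutation σ σ σσ σσ)

subset-of-size : ∀ {n} (f : Fin n → Bool) m → m ≤ count f → Σ (Fin n → Bool) λ g → g ⊆ᵇ f × count g ≡ m
subset-of-size {n} f zero _ = (λ _ → false) , (λ _ ()) , count-false {n} (λ _ → false) (λ _ → refl)
subset-of-size {suc n} f (suc m) m<f with f zero in f0
... | true with subset-of-size (f ∘ suc) m (≤-pred m<f)
...   | g , g⊆f , |g| = (λ { zero → true ; (suc x) → g x }) , (λ { zero _ → f0 ; (suc x) → g⊆f x }) , cong suc |g|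
subset-of-size {suc n} f (suc m) m<f | false with subset-of-size (f ∘ suc) (suc m) m<f
...   | g , g⊆f , |g| = (λ { zero → false ; (suc x) → g x }) , (λ { zero () ; (suc x) → g⊆f x }) , |g|

-- Degrees and the expansion condition

adj-flip : ∀ {n} (G : Graph n) {x y} → adj G x y ≡ true → adj G y x ≡ true
adj-flip G {x} {y} xy = trans (adj-sym G y x) xy

adj⇒≢ : ∀ {n} (G : Graph n) {x y} → adj G x y ≡ true → x ≢ y
adj⇒≢ G {x} xy refl = not-¬ xy (adj-irrefl G x)

degree : ∀ {n} → Graph n → Fin n → ℕ
degree G v = count (adj G v)

degreeIn : ∀ {n} → Graph n → (Fin n → Bool) → Fin n → ℕ
degreeIn G s v = count (λ u → adj G v u ∧ s u)

degreeIn-≤ : ∀ {n} (G : Graph n) (s t : Fin n → Bool) v → (∀ u → adj G v u ≡ true → s u ≡ true → t u ≡ true) →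
  degreeIn G s v ≤ count t
degreeIn-≤ G s t v N⊆t = count-mono λ u vu∧su → N⊆t u (∧-conicalˡ _ (s u) vu∧su) (∧-conicalʳ (adj G v u) _ vu∧su)

degreeIn-< : ∀ {n} (G : Graph n) (s : Fin n → Bool) v → s v ≡ true → degreeIn G s v < count s
degreeIn-< G s v sv = count-mono-< (λ u → ∧-conicalʳ (adj G v u) (s u)) v (cong (_∧ s v) (adj-irrefl G v)) sv

∣tabulate∣ : ∀ {n} (f : Fin n → Bool) → ∣ tabulate f ∣ ≡ count f
∣tabulate∣ {zero}  f = refl
∣tabulate∣ {suc n} f with f zero
... | true  = cong suc (∣tabulate∣ (f ∘ suc))
... | false = ∣tabulate∣ (f ∘ suc)

Λ-tabulate : ∀ {n} k (G : Graph n) (s : Fin n → Bool) → Λ k G (tabulate s) ≡ tabulate (λ v → k ≤ᵇ degreeIn G s v)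
Λ-tabulate k G s = tabulate-cong λ v → cong (k ≤ᵇ_) (trans (cong ∣_∣ (∩-tabulate (adj G v) s)) (∣tabulate∣ (λ u → adj G v u ∧ s u)))
  where
  ∩-tabulate : ∀ {n} (f g : Fin n → Bool) → tabulate f ∩ tabulate g ≡ tabulate (λ i → f i ∧ g i)
  ∩-tabulate {zero}  f g = refl
  ∩-tabulate {suc n} f g = cong (f zero ∧ g zero ∷_) (∩-tabulate (f ∘ suc) (g ∘ suc))

β-expansion : ∀ {n k} (G : Graph n) → OneLeβ k G → (s t : Fin n → Bool) → k ≤ count s →
  ∀ y → degreeIn G s y < k → (∀ v → k ≤ degreeIn G s v → t v ≡ true) → count s ≤ count t
β-expansion {n} {k} G (_ , β) s t k≤s y sparse-y Λ⊆t = begin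
  count s                                ≡⟨ ∣tabulate∣ s ⟨
  ∣ tabulate s ∣                          ≤⟨ β (tabulate s) (subst (k ≤_) (sym (∣tabulate∣ s)) k≤s) Λ≢V ⟩
  ∣ Λ k G (tabulate s) ∣                  ≡⟨ trans (cong ∣_∣ (Λ-tabulate k G s)) (∣tabulate∣ (λ v → k ≤ᵇ degreeIn G s v)) ⟩
  count (λ v → k ≤ᵇ degreeIn G s v)       ≤⟨ count-mono (λ v k≤ᵇ → Λ⊆t v (≤ᵇ⇒≤ k _ (Equivalence.from T-≡ k≤ᵇ))) ⟩
  count t                                ∎
  where
  open ≤-Reasoning
  Λ≢V : ¬ (∀ v → v ∈ Λ k G (tabulate s))
  Λ≢V all = <⇒≱ sparse-y (≤ᵇ⇒≤ k _ (Equivalence.from T-≡ (trans (sym (lookup∘tabulate _ y))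
                           ([]=⇒lookup (subst (y ∈_) (Λ-tabulate k G s) (all y))))))

degreeIn-full : ∀ {n} (G : Graph n) v → degreeIn G (λ _ → true) v ≡ degree G v
degreeIn-full G v = count-cong λ u → ∧-identityʳ (adj G v u)

β⇒degree-≥ : ∀ {n k} (G : Graph n) → OneLeβ k G → ∀ v → k ≤ degree G v
β⇒degree-≥ {n} {k} G β v with k ≤? degree G v
... | yes k≤deg = k≤deg
... | no  k≰deg = ⊥-elim (<⇒≱ V-v<V V≤V-v)
  where
  sparse-v : degreeIn G (λ _ → true) v < k
  sparse-v = subst (_< k) (sym (degreeIn-full G v)) (≰⇒> k≰deg)
  V≤V-v : count {n} (λ _ → true) ≤ count (λ u → not (u == v))
  V≤V-v = β-expansion G β (λ _ → true) (λ u → not (u == v)) (subst (k ≤_) (sym (count-true n)) (proj₁ β))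
    v sparse-v (λ u k≤u → cong not (¬-not λ u==v → <⇒≱ sparse-v (subst (λ w → k ≤ degreeIn G _ w) (==⇒≡ u==v) k≤u)))
  V-v<V : count (λ u → not (u == v)) < count {n} (λ _ → true)
  V-v<V = count-mono-< (λ _ _ → refl) v (cong not (==-refl v)) refl

β⇒degree-≥-2k-1 : ∀ {n k} (G : Graph n) → OneLeβ (suc k) G → ∀ v → suc k + k ≤ degree G v
β⇒degree-≥-2k-1 {n} {k} G β v = begin
  suc k + k                                  ≡⟨ +-comm (suc k) k ⟩
  k + suc k                                  ≤⟨ +-monoʳ-≤ k (subst (_≤ count t) |s| (β-expansion G β s t (≤-reflexive (sym |s|)) v sparse-v Λ⊆t)) ⟩
  k + count t                                ≡⟨ cong (_+ count t) |B| ⟨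
  count B + count t                          ≤⟨ +-monoˡ-≤ (count t) (count-mono λ u Bu → cong₂ _∧_ (B⊆N u Bu) Bu) ⟩
  count (λ u → adj G v u ∧ B u) + count t    ≡⟨ count-split (adj G v) B ⟨
  degree G v                                 ∎
  where
  open ≤-Reasoning
  chosen : Σ (Fin n → Bool) λ B → B ⊆ᵇ adj G v × count B ≡ k
  chosen = subset-of-size (adj G v) k (≤-trans (n≤1+n k) (β⇒degree-≥ G β v))
  B : Fin n → Bool
  B = proj₁ chosen
  B⊆N : B ⊆ᵇ adj G v
  B⊆N = proj₁ (proj₂ chosen)
  |B| : count B ≡ k
  |B| = proj₂ (proj₂ chosen)
  s t : Fin n → Bool
  s u = (u == v) ∨ B u
  t u = adj G v u ∧ not (B u)
  |s| : count s ≡ suc k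
  |s| = trans (count-∨-disjoint (_== v) B v∉B) (cong₂ _+_ (count-singleton v) |B|)
    where
    v∉B : ∀ u → u == v ≡ true → B u ≡ true → ⊥
    v∉B u u==v Bu = adj⇒≢ G (B⊆N u Bu) (sym (==⇒≡ u==v))
  non-neighbour-sparse : ∀ y → adj G y v ≡ false → degreeIn G s y ≤ k
  non-neighbour-sparse y yv = subst (degreeIn G s y ≤_) |B| (degreeIn-≤ G s B y in-B)
    where
    in-B : ∀ u → adj G y u ≡ true → s u ≡ true → B u ≡ true
    in-B u yu su with ∨-true⁻ (u == v) su
    ... | inj₁ u==v = ⊥-elim (not-¬ (subst (λ w → adj G y w ≡ true) (==⇒≡ u==v) yu) yv)
    ... | inj₂ Bu = Bu
  sparse-v : degreeIn G s v < suc k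
  sparse-v = s≤s (non-neighbour-sparse v (adj-irrefl G v))
  Λ⊆t : ∀ y → suc k ≤ degreeIn G s y → t y ≡ true
  Λ⊆t y dense with true-or-false (adj G y v) | true-or-false (B y)
  ... | inj₂ yv | _       = ⊥-elim (<⇒≱ (s≤s (non-neighbour-sparse y yv)) dense)
  ... | inj₁ _  | inj₁ By = ⊥-elim (<⇒≱ (subst (degreeIn G s y <_) |s| (degreeIn-< G s y (∨-trueʳ (y == v) By))) dense)
  ... | inj₁ yv | inj₂ ¬By = cong₂ _∧_ (adj-flip G yv) (cong not ¬By)

record Deficient {n} (G : Graph n) (F : Fin n → Fin n → Bool) (k : ℕ) : Set where
  field
    s c u : Fin n → Bool
    x₀ y₀ : Fin n
    x₀∈c : c x₀ ≡ true
    N[x₀]⊆F∪c∪u : ∀ y → adj G x₀ y ≡ true → F x₀ y ≡ true ⊎ c y ≡ true ⊎ u y ≡ true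
    sparse-outside : ∀ y → c y ≡ false → u y ≡ false → degreeIn G s y < k
    y₀∈s : s y₀ ≡ true
    y₀∉c : c y₀ ≡ false
    y₀∉u : u y₀ ≡ false
    c+u<s : count c + count u < count s

β⇒¬Deficient : ∀ {n j} (G : Graph n) → OneLeβ (suc (suc j)) G →
  (F : Fin n → Fin n → Bool) → (∀ x → count (F x) ≤ j) → ¬ Deficient G F (suc (suc j))
β⇒¬Deficient {n} {j} G β F ΔF≤j D = <⇒≱ c+u<s s≤c+u
  where
  open Deficient D
  k : ℕ
  k = suc (suc j)
  c-x₀ : Fin n → Bool
  c-x₀ y = c y ∧ not (y == x₀)
  N[x₀]⊆ : adj G x₀ ⊆ᵇ (λ y → F x₀ y ∨ (c-x₀ y ∨ u y))
  N[x₀]⊆ y x₀y with N[x₀]⊆F∪c∪u y x₀y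
  ... | inj₁ Fy         = cong (_∨ _) Fy
  ... | inj₂ (inj₂ uy)  = ∨-trueʳ (F x₀ y) (∨-trueʳ (c-x₀ y) uy)
  ... | inj₂ (inj₁ cy)  = ∨-trueʳ (F x₀ y) (cong (_∨ u y) (cong₂ _∧_ cy (cong not (dec-false (y ≟ x₀) (adj⇒≢ G x₀y ∘ sym)))))
  k+k≤j+[c+u] : k + k ≤ j + (count c + count u)
  k+k≤j+[c+u] = begin
    k + k                                          ≡⟨ +-suc k (suc j) ⟩
    suc (k + suc j)                                ≤⟨ s≤s (β⇒degree-≥-2k-1 G β x₀) ⟩
    suc (degree G x₀)                              ≤⟨ s≤s (count-mono N[x₀]⊆) ⟩
    suc (count (λ y → F x₀ y ∨ (c-x₀ y ∨ u y)))    ≤⟨ s≤s (count-∨-≤ (F x₀) _) ⟩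
    suc (count (F x₀) + count (λ y → c-x₀ y ∨ u y)) ≤⟨ s≤s (+-mono-≤ (ΔF≤j x₀) (count-∨-≤ c-x₀ u)) ⟩
    suc (j + (count c-x₀ + count u))               ≡⟨ +-suc j _ ⟨
    j + (suc (count c-x₀) + count u)               ≡⟨ cong (λ m → j + (m + count u)) (count-remove c x₀ x₀∈c) ⟨
    j + (count c + count u)                        ∎
    where open ≤-Reasoning
  k≤c+u : k ≤ count c + count u
  k≤c+u = +-cancelˡ-≤ j k _ (≤-trans (+-monoˡ-≤ k (≤-trans (n≤1+n j) (n≤1+n (suc j)))) k+k≤j+[c+u])
  s≤c+u : count s ≤ count c + count u
  s≤c+u = ≤-trans (β-expansion G β s (λ y → c y ∨ u y) (≤-trans k≤c+u (<⇒≤ c+u<s)) y₀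
                      (sparse-outside y₀ y₀∉c y₀∉u) Λ⊆c∪u)
                  (count-∨-≤ c u)
    where
    Λ⊆c∪u : ∀ y → k ≤ degreeIn G s y → c y ∨ u y ≡ true
    Λ⊆c∪u y dense with true-or-false (c y) | true-or-false (u y)
    ... | inj₁ cy  | _        = cong (_∨ u y) cy
    ... | inj₂ _   | inj₁ uy  = ∨-trueʳ (c y) uy
    ... | inj₂ ¬cy | inj₂ ¬uy = ⊥-elim (<⇒≱ (sparse-outside y ¬cy ¬uy) dense)

-- Perfect matchings

transpose-matchˡ : ∀ {n} (i j : Fin n) → transpose i j i ≡ j
transpose-matchˡ i j rewrite dec-true (i ≟ i) refl = refl

transpose-matchʳ : ∀ {n} (i j : Fin n) → transpose i j j ≡ i
transpose-matchʳ i j with j ≟ i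
... | yes refl = refl
... | no  _    rewrite dec-true (j ≟ j) refl = refl

transpose-other : ∀ {n} {i j k : Fin n} → k ≢ i → k ≢ j → transpose i j k ≡ k
transpose-other {i = i} {j} {k} k≢i k≢j rewrite dec-false (k ≟ i) k≢i | dec-false (k ≟ j) k≢j = refl

transpose-involutive : ∀ {n} (i j k : Fin n) → transpose i j (transpose i j k) ≡ k
transpose-involutive i j k = by-cases (k ≟ i) (k ≟ j)
  where
  by-cases : Dec (k ≡ i) → Dec (k ≡ j) → transpose i j (transpose i j k) ≡ k
  by-cases (yes refl) _          = trans (cong (transpose k j) (transpose-matchˡ k j)) (transpose-matchʳ k j)
  by-cases (no _)     (yes refl) = trans (cong (transpose i k) (transpose-matchʳ i k)) (transpose-matchˡ i k)
  by-cases (no k≢i)   (no k≢j)   = trans (cong (transpose i j) (transpose-other k≢i k≢j)) (transpose-other k≢i k≢j)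

_⊆ᴳ_ : ∀ {n} → Graph n → Graph n → Set
H ⊆ᴳ H′ = ∀ x y → adj H x y ≡ true → adj H′ x y ≡ true

record PerfectMatching {n} (H : Graph n) : Set where
  field
    partner            : Fin n → Fin n
    partner-involutive : ∀ x → partner (partner x) ≡ x
    partner-≢          : ∀ x → partner x ≢ x
    partner-adj        : ∀ x → adj H x (partner x) ≡ true

  partner-flip : ∀ {x y} → partner x ≡ y → partner y ≡ x
  partner-flip {x} px≡y = trans (cong partner (sym px≡y)) (partner-involutive x)

  partner-injective : ∀ {x y} → partner x ≡ partner y → x ≡ y
  partner-injective {x} {y} eq = trans (sym (partner-involutive x)) (trans (cong partner eq) (partner-involutive y))

data Even : ℕ → Set where
  even-zero : Even zero
  even-2+   : ∀ {n} → Even n → Even (suc (suc n))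

perfectMatching-complete : ∀ {n} → Even n → (H : Graph n) → (∀ x y → x ≢ y → adj H x y ≡ true) → PerfectMatching H
perfectMatching-complete {n} ev H complete = record
  { partner = pairUp ev ; partner-involutive = pairUp-involutive ev ; partner-≢ = pairUp-≢ ev
  ; partner-adj = λ x → complete x (pairUp ev x) (pairUp-≢ ev x ∘ sym) }
  where
  pairUp : ∀ {m} → Even m → Fin m → Fin m
  pairUp (even-2+ e) zero          = suc zero
  pairUp (even-2+ e) (suc zero)    = zero
  pairUp (even-2+ e) (suc (suc i)) = suc (suc (pairUp e i))
  pairUp-involutive : ∀ {m} (e : Even m) x → pairUp e (pairUp e x) ≡ x
  pairUp-involutive (even-2+ e) zero          = refl
  pairUp-involutive (even-2+ e) (suc zero)    = refl
  pairUp-involutive (even-2+ e) (suc (suc i)) = cong (λ j → suc (suc j)) (pairUp-involutive e i)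
  pairUp-≢ : ∀ {m} (e : Even m) x → pairUp e x ≢ x
  pairUp-≢ (even-2+ e) (suc (suc i)) eq = pairUp-≢ e i (suc-injective (suc-injective eq))

isPair : ∀ {n} → Fin n → Fin n → Fin n → Fin n → Bool
isPair a c x y = (x == a ∧ y == c) ∨ (x == c ∧ y == a)

isPair⁻ : ∀ {n} (a c x y : Fin n) → isPair a c x y ≡ true → (x ≡ a × y ≡ c) ⊎ (x ≡ c × y ≡ a)
isPair⁻ a c x y p with ∨-true⁻ (x == a ∧ y == c) p
... | inj₁ q = inj₁ (==⇒≡ (∧-conicalˡ _ _ q) , ==⇒≡ (∧-conicalʳ (x == a) _ q))
... | inj₂ q = inj₂ (==⇒≡ (∧-conicalˡ _ _ q) , ==⇒≡ (∧-conicalʳ (x == c) _ q))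

addEdge : ∀ {n} (H : Graph n) (a c : Fin n) → a ≢ c → Graph n
addEdge H a c a≢c = record
  { adj    = λ x y → adj H x y ∨ isPair a c x y
  ; sym    = λ x y → cong₂ _∨_ (adj-sym H x y) (isPair-sym x y)
  ; irrefl = λ x → trans (cong (_∨ isPair a c x x) (adj-irrefl H x)) (¬-not (¬isPair-xx x))
  }
  where
  isPair-sym : ∀ x y → isPair a c x y ≡ isPair a c y x
  isPair-sym x y = trans (∨-comm (x == a ∧ y == c) _) (cong₂ _∨_ (∧-comm (x == c) (y == a)) (∧-comm (x == a) (y == c)))
  ¬isPair-xx : ∀ x → isPair a c x x ≢ true
  ¬isPair-xx x p with isPair⁻ a c x x p
  ... | inj₁ (x≡a , x≡c) = a≢c (trans (sym x≡a) x≡c)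
  ... | inj₂ (x≡c , x≡a) = a≢c (trans (sym x≡a) x≡c)

⊆addEdge : ∀ {n} (H : Graph n) a c a≢c → H ⊆ᴳ addEdge H a c a≢c
⊆addEdge H a c a≢c x y xy = cong (_∨ isPair a c x y) xy

addEdge-adj-new : ∀ {n} (H : Graph n) a c a≢c → adj (addEdge H a c a≢c) a c ≡ true
addEdge-adj-new H a c _ = ∨-trueʳ (adj H a c) (cong (_∨ ((a == c) ∧ (c == a))) (cong₂ _∧_ (==-refl a) (==-refl c)))

addEdge-adj⁻ : ∀ {n} (H : Graph n) a c a≢c {x y} → adj (addEdge H a c a≢c) x y ≡ true → x ≢ a → x ≢ c → adj H x y ≡ true
addEdge-adj⁻ H a c a≢c {x} {y} xy x≢a x≢c with ∨-true⁻ (adj H x y) xy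
... | inj₁ old = old
... | inj₂ new with isPair⁻ a c x y new
...   | inj₁ (x≡a , _) = contradiction x≡a x≢a
...   | inj₂ (x≡c , _) = contradiction x≡c x≢c

restrict : ∀ {n} (H : Graph n) a c a≢c (M : PerfectMatching (addEdge H a c a≢c)) →
  PerfectMatching.partner M a ≢ c → PerfectMatching H
restrict H a c a≢c M pa≢c = record
  { partner = partner ; partner-involutive = partner-involutive ; partner-≢ = partner-≢ ; partner-adj = old-edge }
  where
  open PerfectMatching M
  old-edge : ∀ z → adj H z (partner z) ≡ true
  old-edge z with ∨-true⁻ (adj H z (partner z)) (partner-adj z)
  ... | inj₁ old = old
  ... | inj₂ new with isPair⁻ a c z (partner z) new
  ...   | inj₁ (refl , pz≡c) = contradiction pz≡c pa≢c
  ...   | inj₂ (refl , pz≡a) = contradiction (partner-flip pz≡a) pa≢c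

module _ {n} {H : Graph n} (M : PerfectMatching H) where
  open PerfectMatching M

  IsExchange : ∀ {H′ : Graph n} → PerfectMatching H′ → Fin n → Fin n → Fin n → Set
  IsExchange M′ x y u = p′ x ≡ u × p′ y ≡ partner u × (∀ z → z ≢ x → z ≢ y → z ≢ u → z ≢ partner u → p′ z ≡ partner z)
    where
    p′ : Fin n → Fin n
    p′ = PerfectMatching.partner M′

  -- Conjugating partner by the transposition of y and u turns the pairs
  -- {x, y}, {u, partner u} into {x, u}, {y, partner u}.
  exchange : ∀ {H′ : Graph n} {x y u} → partner x ≡ y → u ≢ x → u ≢ y →
    adj H′ x u ≡ true → adj H′ y (partner u) ≡ true →
    (∀ z → z ≢ x → z ≢ y → z ≢ u → z ≢ partner u → adj H′ z (partner z) ≡ true) →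
    Σ (PerfectMatching H′) λ M′ → IsExchange M′ x y u
  exchange {H′} {x} {y} {u} px≡y u≢x u≢y xu y-pu elsewhere =
    record { partner = p′ ; partner-involutive = p′-involutive ; partner-≢ = p′-≢ ; partner-adj = p′-adj }
    , p′x≡u , p′y≡v , p′-elsewhere
    where
    τ : Fin n → Fin n
    τ = transpose y u
    v : Fin n
    v = partner u
    p′ : Fin n → Fin n
    p′ z = τ (partner (τ z))
    p′-involutive : ∀ z → p′ (p′ z) ≡ z
    p′-involutive z = trans (cong (τ ∘ partner) (transpose-involutive y u (partner (τ z))))
                            (trans (cong τ (partner-involutive (τ z))) (transpose-involutive y u z))
    p′-≢ : ∀ z → p′ z ≢ z
    p′-≢ z eq = partner-≢ (τ z) (trans (sym (transpose-involutive y u (partner (τ z)))) (cong τ eq))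
    py≡x : partner y ≡ x
    py≡x = partner-flip px≡y
    x≢y : x ≢ y
    x≢y x≡y = partner-≢ x (trans px≡y (sym x≡y))
    v≢y : v ≢ y
    v≢y v≡y = u≢x (partner-injective (trans v≡y (sym px≡y)))
    v≢x : v ≢ x
    v≢x v≡x = u≢y (partner-injective (trans v≡x (sym py≡x)))
    v≢u : v ≢ u
    v≢u = partner-≢ u
    p′x≡u : p′ x ≡ u
    p′x≡u = trans (cong (τ ∘ partner) (transpose-other x≢y (u≢x ∘ sym))) (trans (cong τ px≡y) (transpose-matchˡ y u))
    p′u≡x : p′ u ≡ x
    p′u≡x = trans (cong (τ ∘ partner) (transpose-matchʳ y u)) (trans (cong τ py≡x) (transpose-other x≢y (u≢x ∘ sym)))
    p′y≡v : p′ y ≡ v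
    p′y≡v = trans (cong (τ ∘ partner) (transpose-matchˡ y u)) (transpose-other v≢y v≢u)
    p′v≡y : p′ v ≡ y
    p′v≡y = trans (cong (τ ∘ partner) (transpose-other v≢y v≢u)) (trans (cong τ (partner-involutive u)) (transpose-matchʳ y u))
    p′-elsewhere : ∀ z → z ≢ x → z ≢ y → z ≢ u → z ≢ v → p′ z ≡ partner z
    p′-elsewhere z z≢x z≢y z≢u z≢v =
      trans (cong (τ ∘ partner) (transpose-other z≢y z≢u))
            (transpose-other (λ pz≡y → z≢x (trans (sym (partner-flip pz≡y)) py≡x))
                             (λ pz≡u → z≢v (sym (partner-flip pz≡u))))
    p′-adj : ∀ z → adj H′ z (p′ z) ≡ true
    p′-adj z = by-cases (z ≟ x) (z ≟ u) (z ≟ y) (z ≟ v)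
      where
      at : ∀ {w} → p′ z ≡ w → adj H′ z w ≡ true → adj H′ z (p′ z) ≡ true
      at p′z≡w zw = subst (λ w → adj H′ z w ≡ true) (sym p′z≡w) zw
      by-cases : Dec (z ≡ x) → Dec (z ≡ u) → Dec (z ≡ y) → Dec (z ≡ v) → adj H′ z (p′ z) ≡ true
      by-cases (yes refl) _          _          _          = at p′x≡u xu
      by-cases (no _)     (yes refl) _          _          = at p′u≡x (adj-flip H′ xu)
      by-cases (no _)     (no _)     (yes refl) _          = at p′y≡v y-pu
      by-cases (no _)     (no _)     (no _)     (yes refl) = at p′v≡y (adj-flip H′ y-pu)
      by-cases (no z≢x)   (no z≢u)   (no z≢y)   (no z≢v)   =
        at (p′-elsewhere z z≢x z≢y z≢u z≢v) (elsewhere z z≢x z≢y z≢u z≢v)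

-- Lovász's proof of Tutte's theorem

universal? : ∀ {n} (H : Graph n) x → Dec (∀ y → y ≡ x ⊎ adj H x y ≡ true)
universal? H x = all? λ y → (y ≟ x) ⊎-dec (adj H x y ≟ᴮ true)

universal : ∀ {n} → Graph n → Fin n → Bool
universal H x = does (universal? H x)

universal⇒adj : ∀ {n} (H : Graph n) {x} → universal H x ≡ true → ∀ y → y ≢ x → adj H x y ≡ true
universal⇒adj H {x} ux y y≢x with does⇒ (universal? H x) ux y
... | inj₁ y≡x = contradiction y≡x y≢x
... | inj₂ xy  = xy

¬universal⇒non-neighbour : ∀ {n} (H : Graph n) {x} → universal H x ≡ false → ∃ λ y → y ≢ x × adj H x y ≡ false
¬universal⇒non-neighbour {n} H {x} ¬ux with ¬∀⟶∃¬ n _ (λ y → (y ≟ x) ⊎-dec (adj H x y ≟ᴮ true)) (¬does⇒ (universal? H x) ¬ux)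
... | y , ¬[y≡x⊎xy] = y , (¬[y≡x⊎xy] ∘ inj₁) , ¬-not (¬[y≡x⊎xy] ∘ inj₂)

non-neighbour⇒¬universal : ∀ {n} (H : Graph n) {x y} → adj H x y ≡ false → y ≢ x → universal H x ≡ false
non-neighbour⇒¬universal H {x} {y} ¬xy y≢x = ¬-not λ ux → not-¬ (universal⇒adj H ux y y≢x) ¬xy

universal-≢ : ∀ {n} (H : Graph n) {u w} → universal H u ≡ true → universal H w ≡ false → u ≢ w
universal-≢ H uu ¬uw refl = not-¬ uu ¬uw

universal-adj : ∀ {n} (H : Graph n) {u w} → universal H u ≡ true → universal H w ≡ false → adj H w u ≡ true
universal-adj H {u} {w} uu ¬uw = adj-flip H (universal⇒adj H uu w (universal-≢ H uu ¬uw ∘ sym))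

PerfectOn : ∀ {n} → Graph n → (Fin n → Bool) → Bool → (Fin n → Fin n) → Set
PerfectOn H Z side f = ∀ z → Z z ≡ side → Z (f z) ≡ side × f (f z) ≡ z × f z ≢ z × adj H z (f z) ≡ true

splice : ∀ {n} {H : Graph n} (Z : Fin n → Bool) {f g : Fin n → Fin n} →
  PerfectOn H Z true f → PerfectOn H Z false g → PerfectMatching H
splice {n} {H} Z {f} {g} on-Z off-Z = record
  { partner = h ; partner-involutive = h-involutive ; partner-≢ = h-≢ ; partner-adj = h-adj }
  where
  h : Fin n → Fin n
  h z = if Z z then f z else g z
  h-involutive : ∀ z → h (h z) ≡ z
  h-involutive z with Z z in Zz
  ... | true  rewrite proj₁ (on-Z z Zz)  = proj₁ (proj₂ (on-Z z Zz))
  ... | false rewrite proj₁ (off-Z z Zz) = proj₁ (proj₂ (off-Z z Zz))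
  h-≢ : ∀ z → h z ≢ z
  h-≢ z with Z z in Zz
  ... | true  = proj₁ (proj₂ (proj₂ (on-Z z Zz)))
  ... | false = proj₁ (proj₂ (proj₂ (off-Z z Zz)))
  h-adj : ∀ z → adj H z (h z) ≡ true
  h-adj z with Z z in Zz
  ... | true  = proj₂ (proj₂ (proj₂ (on-Z z Zz)))
  ... | false = proj₂ (proj₂ (proj₂ (off-Z z Zz)))

complement-closed : ∀ {n} (Z : Fin n → Bool) (g : Fin n → Fin n) → (∀ z → g (g z) ≡ z) →
  (∀ z → Z z ≡ true → Z (g z) ≡ true) → ∀ z → Z z ≡ false → Z (g z) ≡ false
complement-closed Z g g-involutive closed z ¬Zz =
  ¬-not λ Zgz → not-¬ (subst (λ w → Z w ≡ true) (g-involutive z) (closed (g z) Zgz)) ¬Zz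

first-or-none : ∀ {P : ℕ → Set} → (∀ l → Dec (P l)) → ∀ B →
  (∃ λ i → i < B × P i × (∀ l → l < i → ¬ P l)) ⊎ (∀ l → l < B → ¬ P l)
first-or-none P? zero = inj₂ λ _ ()
first-or-none {P} P? (suc B) with first-or-none P? B
... | inj₁ (i , i<B , Pi , before) = inj₁ (i , m≤n⇒m≤1+n i<B , Pi , before)
... | inj₂ none with P? B
...   | yes PB = inj₁ (B , ≤-refl , PB , none)
...   | no ¬PB = inj₂ λ l l<1+B → case-≟ l (l ≟ℕ B) (≤-pred l<1+B)
  where
  case-≟ : ∀ l → Dec (l ≡ B) → l ≤ B → ¬ P l
  case-≟ l (yes refl) _   = ¬PB
  case-≟ l (no l≢B)   l≤B = none l (≤∧≢⇒< l≤B l≢B)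

-- Starting at d, follow M₁ and M₂ alternately:
-- d = xs 0 –M₁– ys 0 –M₂– xs 1 –M₁– ys 1 – ⋯ .  This closed walk returns to d
-- through b.  If it avoids a and c, take M₁ on it and M₂ elsewhere; otherwise,
-- stopping at the first xs i ∈ {a, c}, take M₁ on the walk before i, the edge
-- b xs i, and M₂ elsewhere.
module AlternatingWalk {n} (H : Graph n) {a b c d : Fin n}
  (ab : adj H a b ≡ true) (bc : adj H b c ≡ true) (a≢c : a ≢ c) (b≢d : b ≢ d) (¬bd : adj H b d ≡ false)
  (M₁ : PerfectMatching (addEdge H a c a≢c)) (M₂ : PerfectMatching (addEdge H b d b≢d))
  (p₁a≡c : PerfectMatching.partner M₁ a ≡ c) (p₂b≡d : PerfectMatching.partner M₂ b ≡ d) where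

  open PerfectMatching M₁ using () renaming
    (partner to p₁; partner-involutive to p₁-involutive; partner-≢ to p₁-≢; partner-adj to p₁-adj;
     partner-flip to p₁-flip; partner-injective to p₁-injective)
  open PerfectMatching M₂ using () renaming
    (partner to p₂; partner-involutive to p₂-involutive; partner-≢ to p₂-≢; partner-adj to p₂-adj;
     partner-flip to p₂-flip; partner-injective to p₂-injective)

  xs : ℕ → Fin n
  xs zero    = d
  xs (suc l) = p₂ (p₁ (xs l))

  ys : ℕ → Fin n
  ys l = p₁ (xs l)

  p₂-xs : ∀ l → p₂ (xs (suc l)) ≡ ys l
  p₂-xs l = p₂-involutive (ys l)

  ys-shift : ∀ l m → ys (suc l) ≡ xs m → ys l ≡ xs (suc m)
  ys-shift l m eq = sym (trans (cong p₂ (p₁-flip eq)) (p₂-xs l))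

  ys≢xs-+ : ∀ δ m → ys (δ + m) ≢ xs m
  ys≢xs-+ zero          m eq = p₁-≢ (xs m) eq
  ys≢xs-+ (suc zero)    m eq = p₂-≢ (xs (suc m)) (trans (p₂-xs m) (ys-shift m m eq))
  ys≢xs-+ (suc (suc δ)) m eq =
    ys≢xs-+ δ (suc m) (subst (λ t → ys t ≡ xs (suc m)) (sym (+-suc δ m)) (ys-shift (suc δ + m) m eq))

  -- The walk alternates, so no M₁-edge joins two of its even positions.
  ys≢xs : ∀ l m → ys l ≢ xs m
  ys≢xs l m eq with ≤-total m l
  ... | inj₁ m≤l = ys≢xs-+ (l ∸ m) m (subst (λ t → ys t ≡ xs m) (sym (m∸n+n≡m m≤l)) eq)
  ... | inj₂ l≤m = ys≢xs-+ (m ∸ l) l (subst (λ t → ys t ≡ xs l) (sym (m∸n+n≡m l≤m)) (p₁-flip eq))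

  xs-return : ∀ i j → i < j → xs i ≡ xs j → ∃ λ P → xs (suc P) ≡ d
  xs-return zero    (suc j) _         eq = j , sym eq
  xs-return (suc i) (suc j) (s≤s i<j) eq = xs-return i j i<j (p₁-injective (p₂-injective eq))

  xs-periodic : ∀ P → xs P ≡ d → ∀ t → xs (P + t) ≡ xs t
  xs-periodic P xsP≡d zero    = trans (cong xs (+-identityʳ P)) xsP≡d
  xs-periodic P xsP≡d (suc t) = trans (cong xs (+-suc P t)) (cong (p₂ ∘ p₁) (xs-periodic P xsP≡d t))

  period : ∃ λ P → xs (suc P) ≡ d
  period with pigeonhole (n<1+n n) (λ (i : Fin (suc n)) → xs (toℕ i))
  ... | i , j , i<j , eq = xs-return (toℕ i) (toℕ j) i<j eq

  Hits : ℕ → Set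
  Hits l = xs l ≡ a ⊎ xs l ≡ c

  hits? : ∀ l → Dec (Hits l)
  hits? l = (xs l ≟ a) ⊎-dec (xs l ≟ c)

  walk-avoids-a,c : ∀ l → ¬ Hits l → ∀ z → z ≡ xs l ⊎ z ≡ ys l → z ≢ a × z ≢ c
  walk-avoids-a,c l ¬hit z (inj₁ refl) = ¬hit ∘ inj₁ , ¬hit ∘ inj₂
  walk-avoids-a,c l ¬hit z (inj₂ refl) =
    (λ ys≡a → ¬hit (inj₂ (trans (sym (p₁-involutive (xs l))) (trans (cong p₁ ys≡a) p₁a≡c)))) ,
    (λ ys≡c → ¬hit (inj₁ (trans (sym (p₁-involutive (xs l))) (trans (cong p₁ ys≡c) (p₁-flip p₁a≡c)))))

  onWalk? : ∀ B z → Dec (∃ λ l → l < B × (z ≡ xs l ⊎ z ≡ ys l))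
  onWalk? B z = anyUpTo? (λ l → (z ≟ xs l) ⊎-dec (z ≟ ys l)) B

  -- Opaque, since unfolding anyUpTo? at suc B defeats inference of B and z.
  opaque
    onWalk : ℕ → Fin n → Bool
    onWalk B z = does (onWalk? B z)

    onWalk⁻ : ∀ {B z} → onWalk B z ≡ true → ∃ λ l → l < B × (z ≡ xs l ⊎ z ≡ ys l)
    onWalk⁻ {B} {z} = does⇒ (onWalk? B z)

    xs-onWalk : ∀ {B l z} → l < B → z ≡ xs l → onWalk B z ≡ true
    xs-onWalk {B} {l} {z} l<B z≡xs = dec-true (onWalk? B z) (l , l<B , inj₁ z≡xs)

    ys-onWalk : ∀ {B l z} → l < B → z ≡ ys l → onWalk B z ≡ true
    ys-onWalk {B} {l} {z} l<B z≡ys = dec-true (onWalk? B z) (l , l<B , inj₂ z≡ys)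

  onWalk-p₁ : ∀ {B z} → onWalk B z ≡ true → onWalk B (p₁ z) ≡ true
  onWalk-p₁ {B} {z} on with onWalk⁻ {B} {z} on
  ... | l , l<B , inj₁ refl = ys-onWalk l<B refl
  ... | l , l<B , inj₂ refl = xs-onWalk l<B (p₁-involutive (xs l))

  module Avoiding (P : ℕ) (closes : xs (suc P) ≡ d) (avoids : ∀ l → l < suc P → ¬ Hits l) where
    Z : Fin n → Bool
    Z = onWalk (suc P)

    ys-last : ys P ≡ b
    ys-last = trans (sym (p₂-xs P)) (trans (cong p₂ closes) (p₂-flip p₂b≡d))

    Z-p₂ : ∀ z → Z z ≡ true → Z (p₂ z) ≡ true
    Z-p₂ z Zz with onWalk⁻ {suc P} {z} Zz
    ... | zero  , _   , inj₁ refl = ys-onWalk {l = P} ≤-refl (trans (p₂-flip p₂b≡d) (sym ys-last))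
    ... | suc l , l<B , inj₁ refl = ys-onWalk (<-trans (n<1+n l) l<B) (p₂-xs l)
    ... | l     , l<B , inj₂ refl with suc l ≟ℕ suc P
    ...   | yes refl = xs-onWalk (s≤s z≤n) closes
    ...   | no  l≢P  = xs-onWalk (≤∧≢⇒< l<B l≢P) refl

    avoids-a,c : ∀ z → Z z ≡ true → z ≢ a × z ≢ c
    avoids-a,c z Zz with onWalk⁻ {suc P} {z} Zz
    ... | l , l<B , on-l = walk-avoids-a,c l (avoids l l<B) z on-l

    on-Z : PerfectOn H Z true p₁
    on-Z z Zz = onWalk-p₁ Zz , p₁-involutive z , p₁-≢ z ,
                addEdge-adj⁻ H a c a≢c (p₁-adj z) (proj₁ (avoids-a,c z Zz)) (proj₂ (avoids-a,c z Zz))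

    off-Z : PerfectOn H Z false p₂
    off-Z z ¬Zz = complement-closed Z p₂ p₂-involutive Z-p₂ z ¬Zz , p₂-involutive z , p₂-≢ z ,
                  addEdge-adj⁻ H b d b≢d (p₂-adj z) (outside (ys-onWalk {l = P} ≤-refl (sym ys-last))) (outside (xs-onWalk {l = 0} (s≤s z≤n) refl))
      where
      outside : ∀ {w} → Z w ≡ true → z ≢ w
      outside Zw refl = not-¬ Zw ¬Zz

    perfectMatching : PerfectMatching H
    perfectMatching = splice Z on-Z off-Z

  module Hitting (i : ℕ) (hit : Hits (suc i)) (before : ∀ l → l < suc i → ¬ Hits l) where
    e : Fin n
    e = xs (suc i)

    W : Fin n → Bool
    W = onWalk (suc i)

    b-e : adj H b e ≡ true
    b-e = b-hit hit
      where
      b-hit : Hits (suc i) → adj H b e ≡ true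
      b-hit (inj₁ e≡a) = subst (λ w → adj H b w ≡ true) (sym e≡a) (adj-flip H ab)
      b-hit (inj₂ e≡c) = subst (λ w → adj H b w ≡ true) (sym e≡c) bc

    -- If b = ys l, the walk would already return to d at step l + 1 ≤ i + 1,
    -- and then meet e earlier.
    b∉W : W b ≡ false
    b∉W = ¬-not b∈W⇒⊥
      where
      b∈W⇒⊥ : W b ≢ true
      b∈W⇒⊥ Wb with onWalk⁻ {suc i} {b} Wb
      ... | zero  , _   , inj₁ b≡d  = b≢d b≡d
      ... | suc l , _   , inj₁ b≡xs = ys≢xs l 0 (trans (sym (p₂-xs l)) (trans (cong p₂ (sym b≡xs)) p₂b≡d))
      ... | l     , l<B , inj₂ b≡ys =
        before (suc i ∸ suc l) (∸-monoʳ-< (s≤s z≤n) l<B) (subst (λ w → w ≡ a ⊎ w ≡ c) earlier hit)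
        where
        earlier : xs (suc i) ≡ xs (suc i ∸ suc l)
        earlier = trans (cong xs (sym (m+[n∸m]≡n l<B)))
                        (xs-periodic (suc l) (trans (cong p₂ (sym b≡ys)) p₂b≡d) (suc i ∸ suc l))

    e∉W : W e ≡ false
    e∉W = ¬-not e∈W⇒⊥
      where
      e∈W⇒⊥ : W e ≢ true
      e∈W⇒⊥ We with onWalk⁻ {suc i} {e} We
      ... | l , l<B , inj₁ e≡xs = before l l<B (subst (λ w → w ≡ a ⊎ w ≡ c) e≡xs hit)
      ... | l , l<B , inj₂ e≡ys = ys≢xs l (suc i) (sym e≡ys)

    outside-W : ∀ {z w} → W z ≡ true → W w ≡ false → z ≢ w
    outside-W Wz ¬Ww refl = not-¬ Wz ¬Ww

    Z : Fin n → Bool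
    Z z = (z == b) ∨ ((z == e) ∨ W z)

    data InZ (z : Fin n) : Set where
      is-b : z ≡ b → InZ z
      is-e : z ≡ e → InZ z
      in-W : W z ≡ true → InZ z

    Z⁻ : ∀ z → Z z ≡ true → InZ z
    Z⁻ z Zz with ∨-true⁻ (z == b) Zz
    ... | inj₁ z==b = is-b (==⇒≡ z==b)
    ... | inj₂ rest with ∨-true⁻ (z == e) rest
    ...   | inj₁ z==e = is-e (==⇒≡ z==e)
    ...   | inj₂ Wz   = in-W Wz

    Z⁺ : ∀ {z} → InZ z → Z z ≡ true
    Z⁺ {z} (is-b refl) = cong (_∨ ((z == e) ∨ W z)) (==-refl z)
    Z⁺ {z} (is-e refl) = ∨-trueʳ (z == b) (cong (_∨ W z) (==-refl z))
    Z⁺ {z} (in-W Wz)   = ∨-trueʳ (z == b) (∨-trueʳ (z == e) Wz)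

    Z-p₂ : ∀ z → Z z ≡ true → Z (p₂ z) ≡ true
    Z-p₂ z Zz with Z⁻ z Zz
    ... | is-b refl = Z⁺ (in-W (xs-onWalk {l = 0} (s≤s z≤n) p₂b≡d))
    ... | is-e refl = Z⁺ (in-W (ys-onWalk ≤-refl (p₂-xs i)))
    ... | in-W Wz with onWalk⁻ {suc i} {z} Wz
    ...   | zero  , _   , inj₁ refl = Z⁺ (is-b (p₂-flip p₂b≡d))
    ...   | suc l , l<B , inj₁ refl = Z⁺ (in-W (ys-onWalk (<-trans (n<1+n l) l<B) (p₂-xs l)))
    ...   | l     , l<B , inj₂ refl with suc l ≟ℕ suc i
    ...     | yes refl = Z⁺ (is-e refl)
    ...     | no  l≢i  = Z⁺ (in-W (xs-onWalk (≤∧≢⇒< l<B l≢i) refl))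

    f : Fin n → Fin n
    f z = if z == b then e else (if z == e then b else p₁ z)

    f-b : f b ≡ e
    f-b rewrite ==-refl b = refl

    f-e : f e ≡ b
    f-e rewrite dec-false (e ≟ b) (adj⇒≢ H b-e ∘ sym) | ==-refl e = refl

    f-W : ∀ {z} → W z ≡ true → f z ≡ p₁ z
    f-W {z} Wz rewrite dec-false (z ≟ b) (outside-W Wz b∉W) | dec-false (z ≟ e) (outside-W Wz e∉W) = refl

    on-Z : PerfectOn H Z true f
    on-Z z Zz with Z⁻ z Zz
    ... | is-b refl = subst (λ w → Z w ≡ true) (sym f-b) (Z⁺ (is-e refl)) , trans (cong f f-b) f-e ,
                      (λ fb≡b → adj⇒≢ H b-e (sym (trans (sym f-b) fb≡b))) , subst (λ w → adj H b w ≡ true) (sym f-b) b-e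
    ... | is-e refl = subst (λ w → Z w ≡ true) (sym f-e) (Z⁺ (is-b refl)) , trans (cong f f-e) f-b ,
                      (λ fe≡e → adj⇒≢ H b-e (trans (sym f-e) fe≡e)) , subst (λ w → adj H e w ≡ true) (sym f-e) (adj-flip H b-e)
    ... | in-W Wz   = subst (λ w → Z w ≡ true) (sym (f-W Wz)) (Z⁺ (in-W Wp₁z)) ,
                      trans (cong f (f-W Wz)) (trans (f-W Wp₁z) (p₁-involutive z)) ,
                      (λ fz≡z → p₁-≢ z (trans (sym (f-W Wz)) fz≡z)) ,
                      subst (λ w → adj H z w ≡ true) (sym (f-W Wz)) (addEdge-adj⁻ H a c a≢c (p₁-adj z) z≢a z≢c)
      where
      Wp₁z : W (p₁ z) ≡ true
      Wp₁z = onWalk-p₁ Wz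
      z≢a,c : z ≢ a × z ≢ c
      z≢a,c with onWalk⁻ {suc i} {z} Wz
      ... | l , l<B , on-l = walk-avoids-a,c l (before l l<B) z on-l
      z≢a : z ≢ a
      z≢a = proj₁ z≢a,c
      z≢c : z ≢ c
      z≢c = proj₂ z≢a,c

    off-Z : PerfectOn H Z false p₂
    off-Z z ¬Zz = complement-closed Z p₂ p₂-involutive Z-p₂ z ¬Zz , p₂-involutive z , p₂-≢ z ,
                  addEdge-adj⁻ H b d b≢d (p₂-adj z) (outside (Z⁺ (is-b refl))) (outside (Z⁺ (in-W (xs-onWalk {l = 0} (s≤s z≤n) refl))))
      where
      outside : ∀ {w} → Z w ≡ true → z ≢ w
      outside Zw refl = not-¬ Zw ¬Zz

    perfectMatching : PerfectMatching H
    perfectMatching = splice Z on-Z off-Z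

  perfectMatching : PerfectMatching H
  perfectMatching with period
  ... | P , closes with first-or-none hits? (suc P)
  ...   | inj₂ avoids                     = Avoiding.perfectMatching P closes avoids
  ...   | inj₁ (suc i , _ , hit , before) = Hitting.perfectMatching i hit before
  ...   | inj₁ (zero  , _ , inj₁ d≡a , _) = ⊥-elim (not-¬ (subst (λ w → adj H b w ≡ true) (sym d≡a) (adj-flip H ab)) ¬bd)
  ...   | inj₁ (zero  , _ , inj₂ d≡c , _) = ⊥-elim (not-¬ (subst (λ w → adj H b w ≡ true) (sym d≡c) bc) ¬bd)

CliqueNeighbourhoods : ∀ {n} → Graph n → Set
CliqueNeighbourhoods {n} H =
  ∀ (a b c : Fin n) → universal H b ≡ false → adj H a b ≡ true → adj H b c ≡ true → a ≢ c → adj H a c ≡ true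

-- In an edge-maximal graph without a perfect matching, C is the clique
-- component of x₀ in H − U, and S adds a vertex y₀ of another component and all
-- non-universal vertices matched to U.  This stands in for the count of odd
-- components in Tutte's condition.
record Obstruction {n} (H : Graph n) : Set where
  field
    S C                : Fin n → Bool
    x₀ y₀              : Fin n
    S⊆non-universal    : ∀ z → S z ≡ true → universal H z ≡ false
    C⊆S                : C ⊆ᵇ S
    x₀∈C               : C x₀ ≡ true
    N[x₀]⊆C∪U          : ∀ z → adj H x₀ z ≡ true → C z ≡ true ⊎ universal H z ≡ true
    sparse-outside     : ∀ z → universal H z ≡ false → C z ≡ false → degreeIn H S z ≤ 1
    y₀∈S               : S y₀ ≡ true
    y₀∉C               : C y₀ ≡ false
    C+U<S              : count C + count (universal H) < count S

module CliqueCase {n} (H : Graph n) (cliques : CliqueNeighbourhoods H) {x y : Fin n} (x≢y : x ≢ y)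
  (¬xy : adj H x y ≡ false) (M : PerfectMatching (addEdge H x y x≢y)) (px≡y : PerfectMatching.partner M x ≡ y) where

  open PerfectMatching M renaming (partner to p)

  U : Fin n → Bool
  U = universal H

  ¬yx : adj H y x ≡ false
  ¬yx = trans (adj-sym H y x) ¬xy

  ¬Ux : U x ≡ false
  ¬Ux = non-neighbour⇒¬universal H ¬xy (x≢y ∘ sym)

  ¬Uy : U y ≡ false
  ¬Uy = non-neighbour⇒¬universal H ¬yx x≢y

  py≡x : p y ≡ x
  py≡x = partner-flip px≡y

  old-edge : ∀ z → z ≢ x → z ≢ y → adj H z (p z) ≡ true
  old-edge z z≢x z≢y = addEdge-adj⁻ H x y x≢y (partner-adj z) z≢x z≢y

  MatchedToUniversal : Fin n → Set
  MatchedToUniversal z = U z ≡ false × U (p z) ≡ true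

  matchedToUniversal? : ∀ z → Dec (MatchedToUniversal z)
  matchedToUniversal? z = (U z ≟ᴮ false) ×-dec (U (p z) ≟ᴮ true)

  reroute-universal : ∀ u → U u ≡ true → U (p u) ≡ true → PerfectMatching H
  reroute-universal u Uu Upu = proj₁ (exchange M px≡y (universal-≢ H Uu ¬Ux) (universal-≢ H Uu ¬Uy)
    (universal-adj H Uu ¬Ux) (universal-adj H Upu ¬Uy) (λ z z≢x z≢y _ _ → old-edge z z≢x z≢y))

  reroute-end : ∀ {s t} → p s ≡ t → adj H s t ≡ false → U t ≡ false →
    (∀ z → z ≢ s → z ≢ t → adj H z (p z) ≡ true) → ∀ w → adj H s w ≡ true → MatchedToUniversal w → PerfectMatching H
  reroute-end {s} {t} ps≡t ¬st ¬Ut old w sw (_ , Upw) = proj₁ (exchange M ps≡t (adj⇒≢ H sw ∘ sym)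
    (λ w≡t → not-¬ (subst (λ v → adj H s v ≡ true) w≡t sw) ¬st) sw (universal-adj H Upw ¬Ut) (λ z z≢s z≢t _ _ → old z z≢s z≢t))

  matched⇒≢x : ∀ {w} → MatchedToUniversal w → w ≢ x
  matched⇒≢x (_ , Upx) refl = not-¬ (trans (sym (cong U px≡y)) Upx) ¬Uy

  matched⇒≢y : ∀ {w} → MatchedToUniversal w → w ≢ y
  matched⇒≢y (_ , Upy) refl = not-¬ (trans (sym (cong U py≡x)) Upy) ¬Ux

  -- Two exchanges: {x, y}, {z, p z} become {x, p z}, {y, z} in H + yz, and then
  -- {y, z}, {z′, p z′} become {z, z′}, {y, p z′}.
  reroute-inner : ∀ z z′ → adj H z z′ ≡ true → MatchedToUniversal z → MatchedToUniversal z′ → PerfectMatching H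
  reroute-inner z z′ zz′ Pz@(_ , Upz) Pz′@(¬Uz′ , Upz′) = proj₁ second
    where
    y≢z : y ≢ z
    y≢z = matched⇒≢y Pz ∘ sym
    H+yz : Graph n
    H+yz = addEdge H y z y≢z
    first : Σ (PerfectMatching H+yz) λ M′ → IsExchange M M′ x y (p z)
    first = exchange M px≡y (universal-≢ H Upz ¬Ux) (universal-≢ H Upz ¬Uy)
      (⊆addEdge H y z y≢z x (p z) (universal-adj H Upz ¬Ux))
      (subst (λ v → adj H+yz y v ≡ true) (sym (partner-involutive z)) (addEdge-adj-new H y z y≢z))
      (λ w w≢x w≢y _ _ → ⊆addEdge H y z y≢z w (p w) (old-edge w w≢x w≢y))
    M′ : PerfectMatching H+yz
    M′ = proj₁ first
    open PerfectMatching M′ using () renaming (partner to p′; partner-flip to p′-flip; partner-adj to p′-adj)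
    p′y≡z : p′ y ≡ z
    p′y≡z = trans (proj₁ (proj₂ (proj₂ first))) (partner-involutive z)
    p′z′≡pz′ : p′ z′ ≡ p z′
    p′z′≡pz′ = proj₂ (proj₂ (proj₂ first)) z′ (matched⇒≢x Pz′) (matched⇒≢y Pz′)
      (λ z′≡pz → universal-≢ H Upz ¬Uz′ (sym z′≡pz))
      (λ z′≡ppz → adj⇒≢ H zz′ (sym (trans z′≡ppz (partner-involutive z))))
    second : Σ (PerfectMatching H) λ M″ → IsExchange M′ M″ z y z′
    second = exchange M′ (p′-flip p′y≡z) (adj⇒≢ H zz′ ∘ sym) (matched⇒≢y Pz′)
      zz′ (subst (λ v → adj H y v ≡ true) (sym p′z′≡pz′) (universal-adj H Upz′ ¬Uy))
      (λ w w≢z w≢y _ _ → addEdge-adj⁻ H y z y≢z (p′-adj w) w≢y w≢z)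

  module Stuck (no-universal-pair : ∀ u → U u ≡ true → U (p u) ≢ true)
               (no-x-route : ∀ w → adj H x w ≡ true → ¬ MatchedToUniversal w)
               (no-y-route : ∀ w → adj H y w ≡ true → ¬ MatchedToUniversal w)
               (no-inner-route : ∀ z z′ → adj H z z′ ≡ true → MatchedToUniversal z → ¬ MatchedToUniversal z′) where

    C P S : Fin n → Bool
    C w = (w == x) ∨ (adj H x w ∧ not (U w))
    P w = not (U w) ∧ U (p w)
    S w = C w ∨ ((w == y) ∨ P w)

    P⁻ : ∀ {w} → P w ≡ true → MatchedToUniversal w
    P⁻ {w} Pw = not-injective (∧-conicalˡ (not (U w)) _ Pw) , ∧-conicalʳ (not (U w)) _ Pw

    C⁻ : ∀ {w} → C w ≡ true → w ≡ x ⊎ (adj H x w ≡ true × U w ≡ false)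
    C⁻ {w} Cw with ∨-true⁻ (w == x) Cw
    ... | inj₁ w==x = inj₁ (==⇒≡ w==x)
    ... | inj₂ xw∧¬Uw = inj₂ (∧-conicalˡ (adj H x w) _ xw∧¬Uw , not-injective (∧-conicalʳ (adj H x w) _ xw∧¬Uw))

    data InS (w : Fin n) : Set where
      in-C : C w ≡ true → InS w
      is-y : w ≡ y → InS w
      in-P : MatchedToUniversal w → InS w

    S⁻ : ∀ {w} → S w ≡ true → InS w
    S⁻ {w} Sw with ∨-true⁻ (C w) Sw
    ... | inj₁ Cw = in-C Cw
    ... | inj₂ rest with ∨-true⁻ (w == y) rest
    ...   | inj₁ w==y = is-y (==⇒≡ w==y)
    ...   | inj₂ Pw   = in-P (P⁻ Pw)

    x∈C : C x ≡ true
    x∈C = cong (_∨ (adj H x x ∧ not (U x))) (==-refl x)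

    y∉C : C y ≡ false
    y∉C rewrite dec-false (y ≟ x) (x≢y ∘ sym) | ¬xy = refl

    S⊆non-universal : ∀ w → S w ≡ true → U w ≡ false
    S⊆non-universal w Sw with S⁻ {w} Sw
    ... | in-C Cw with C⁻ {w} Cw
    ...   | inj₁ refl          = ¬Ux
    ...   | inj₂ (_ , ¬Uw)     = ¬Uw
    S⊆non-universal w Sw | is-y refl      = ¬Uy
    S⊆non-universal w Sw | in-P (¬Uw , _) = ¬Uw

    N[x]⊆C∪U : ∀ w → adj H x w ≡ true → C w ≡ true ⊎ U w ≡ true
    N[x]⊆C∪U w xw with true-or-false (U w)
    ... | inj₁ Uw  = inj₂ Uw
    ... | inj₂ ¬Uw = inj₁ (∨-trueʳ (w == x) (cong₂ _∧_ xw (cong not ¬Uw)))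

    -- A neighbour t ∈ S of such a w lies in w's clique component, which is
    -- not that of x; two of them would be adjacent and give a rerouting.
    sparse-outside : ∀ w → U w ≡ false → C w ≡ false → degreeIn H S w ≤ 1
    sparse-outside w ¬Uw ¬Cw = count-≤1 _ unique
      where
      ¬xw : adj H x w ≡ false
      ¬xw = ¬-not λ xw → not-¬ (∨-trueʳ (w == x) (cong₂ _∧_ xw (cong not ¬Uw))) ¬Cw
      w≢x : w ≢ x
      w≢x refl = not-¬ x∈C ¬Cw
      far : ∀ t → adj H w t ≡ true → S t ≡ true → t ≡ y ⊎ MatchedToUniversal t
      far t wt St with S⁻ {t} St
      ... | is-y t≡y = inj₁ t≡y
      ... | in-P Pt  = inj₂ Pt
      ... | in-C Ct with C⁻ {t} Ct
      ...   | inj₁ refl          = ⊥-elim (not-¬ (adj-flip H wt) ¬xw)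
      ...   | inj₂ (xt , ¬Ut)    = ⊥-elim (not-¬ (adj-flip H (cliques w t x ¬Ut wt (adj-flip H xt) w≢x)) ¬xw)
      unique : ∀ t₁ t₂ → adj H w t₁ ∧ S t₁ ≡ true → adj H w t₂ ∧ S t₂ ≡ true → t₁ ≡ t₂
      unique t₁ t₂ wt₁∧St₁ wt₂∧St₂ with t₁ ≟ t₂
      ... | yes t₁≡t₂ = t₁≡t₂
      ... | no  t₁≢t₂ = ⊥-elim (both (far t₁ wt₁ (∧-conicalʳ (adj H w t₁) _ wt₁∧St₁)) (far t₂ wt₂ (∧-conicalʳ (adj H w t₂) _ wt₂∧St₂)))
        where
        wt₁ : adj H w t₁ ≡ true
        wt₁ = ∧-conicalˡ (adj H w t₁) _ wt₁∧St₁
        wt₂ : adj H w t₂ ≡ true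
        wt₂ = ∧-conicalˡ (adj H w t₂) _ wt₂∧St₂
        t₁t₂ : adj H t₁ t₂ ≡ true
        t₁t₂ = cliques t₁ w t₂ ¬Uw (adj-flip H wt₁) wt₂ t₁≢t₂
        both : t₁ ≡ y ⊎ MatchedToUniversal t₁ → t₂ ≡ y ⊎ MatchedToUniversal t₂ → ⊥
        both (inj₁ refl) (inj₁ refl) = t₁≢t₂ refl
        both (inj₁ refl) (inj₂ P₂)   = no-y-route t₂ t₁t₂ P₂
        both (inj₂ P₁)   (inj₁ refl) = no-y-route t₁ (adj-flip H t₁t₂) P₁
        both (inj₂ P₁)   (inj₂ P₂)   = no-inner-route t₁ t₂ t₁t₂ P₁ P₂

    -- U is matched injectively into P.
    U≤P : count U ≤ count P
    U≤P = subst (_≤ count P) (sym (count-involution U p partner-involutive)) (count-mono U∘p⊆P)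
      where
      U∘p⊆P : ∀ w → U (p w) ≡ true → P w ≡ true
      U∘p⊆P w Upw with true-or-false (U w)
      ... | inj₁ Uw  = ⊥-elim (no-universal-pair w Uw Upw)
      ... | inj₂ ¬Uw = cong₂ _∧_ (cong not ¬Uw) Upw

    |S| : count S ≡ count C + suc (count P)
    |S| = trans (count-∨-disjoint C _ C∩[y∪P]) (cong (count C +_) (trans (count-∨-disjoint (_== y) P y∩P) (cong (_+ count P) (count-singleton y))))
      where
      C∩[y∪P] : ∀ w → C w ≡ true → (w == y) ∨ P w ≡ true → ⊥
      C∩[y∪P] w Cw rest with ∨-true⁻ (w == y) rest | C⁻ {w} Cw
      ... | inj₁ w==y | _                = not-¬ (subst (λ v → C v ≡ true) (==⇒≡ w==y) Cw) y∉C
      ... | inj₂ Pw   | inj₁ refl        = matched⇒≢x (P⁻ Pw) refl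
      ... | inj₂ Pw   | inj₂ (xw , _)    = no-x-route w xw (P⁻ Pw)
      y∩P : ∀ w → w == y ≡ true → P w ≡ true → ⊥
      y∩P w w==y Pw = matched⇒≢y (P⁻ Pw) (==⇒≡ w==y)

    obstruction : Obstruction H
    obstruction = record
      { S = S ; C = C ; x₀ = x ; y₀ = y
      ; S⊆non-universal = S⊆non-universal
      ; C⊆S = λ w Cw → cong (_∨ ((w == y) ∨ P w)) Cw
      ; x₀∈C = x∈C
      ; N[x₀]⊆C∪U = N[x]⊆C∪U
      ; sparse-outside = sparse-outside
      ; y₀∈S = ∨-trueʳ (C y) (cong (_∨ P y) (==-refl y))
      ; y₀∉C = y∉C
      ; C+U<S = subst (count C + count U <_) (sym |S|) (subst (_≤ count C + suc (count P)) (+-suc (count C) (count U)) (+-monoʳ-≤ (count C) (s≤s U≤P)))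
      }

  perfectMatching-or-obstruction : PerfectMatching H ⊎ Obstruction H
  perfectMatching-or-obstruction with any? (λ u → (U u ≟ᴮ true) ×-dec (U (p u) ≟ᴮ true))
  ... | yes (u , Uu , Upu) = inj₁ (reroute-universal u Uu Upu)
  ... | no ¬universal-pair with any? (λ w → (adj H x w ≟ᴮ true) ×-dec matchedToUniversal? w)
  ...   | yes (w , xw , Pw) = inj₁ (reroute-end px≡y ¬xy ¬Uy old-edge w xw Pw)
  ...   | no ¬x-route with any? (λ w → (adj H y w ≟ᴮ true) ×-dec matchedToUniversal? w)
  ...     | yes (w , yw , Pw) = inj₁ (reroute-end py≡x ¬yx ¬Ux (λ z z≢y z≢x → old-edge z z≢x z≢y) w yw Pw)
  ...     | no ¬y-route with any? (λ z → any? (λ z′ → (adj H z z′ ≟ᴮ true) ×-dec (matchedToUniversal? z ×-dec matchedToUniversal? z′)))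
  ...       | yes (z , z′ , zz′ , Pz , Pz′) = inj₁ (reroute-inner z z′ zz′ Pz Pz′)
  ...       | no ¬inner-route = inj₂ (Stuck.obstruction
                  (λ u Uu Upu → ¬universal-pair (u , Uu , Upu))
                  (λ w xw Pw → ¬x-route (w , xw , Pw))
                  (λ w yw Pw → ¬y-route (w , yw , Pw))
                  (λ z z′ zz′ Pz Pz′ → ¬inner-route (z , z′ , zz′ , Pz , Pz′)))

ObstructionFree : ∀ {n} → Graph n → Set
ObstructionFree {n} H = ∀ (H′ : Graph n) → H ⊆ᴳ H′ → ¬ Obstruction H′

nonEdges : ∀ {n} → Graph n → ℕ
nonEdges H = sum (λ x → count (λ y → not (adj H x y)))

nonEdges-addEdge : ∀ {n} (H : Graph n) a c a≢c → adj H a c ≡ false → nonEdges (addEdge H a c a≢c) < nonEdges H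
nonEdges-addEdge H a c a≢c ¬ac = sum-mono-< (λ x → count-mono (fewer x)) a
  (count-mono-< (fewer a) c (cong not (addEdge-adj-new H a c a≢c)) (cong not ¬ac))
  where
  fewer : ∀ x y → not (adj (addEdge H a c a≢c) x y) ≡ true → not (adj H x y) ≡ true
  fewer x y ¬new = cong not (¬-not λ xy → not-¬ (⊆addEdge H a c a≢c x y xy) (not-injective ¬new))

CliqueViolation : ∀ {n} → Graph n → Set
CliqueViolation H = ∃ λ a → ∃ λ b → ∃ λ c →
  universal H b ≡ false × adj H a b ≡ true × adj H b c ≡ true × a ≢ c × adj H a c ≡ false

cliqueViolation? : ∀ {n} (H : Graph n) → Dec (CliqueViolation H)
cliqueViolation? H = any? λ a → any? λ b → any? λ c → (universal H b ≟ᴮ false) ×-dec (adj H a b ≟ᴮ true) ×-dec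
                     (adj H b c ≟ᴮ true) ×-dec ¬? (a ≟ c) ×-dec (adj H a c ≟ᴮ false)

NonEdge : ∀ {n} → Graph n → Set
NonEdge H = ∃ λ x → ∃ λ y → x ≢ y × adj H x y ≡ false

nonEdge? : ∀ {n} (H : Graph n) → Dec (NonEdge H)
nonEdge? H = any? λ x → any? λ y → ¬? (x ≟ y) ×-dec (adj H x y ≟ᴮ false)

-- If a non-universal b has non-adjacent neighbours a and c, perfect matchings of
-- H + ac and H + bd combine along an alternating walk.  Otherwise the components
-- of H − U are cliques, and a perfect matching of H + xy either reroutes
-- around xy or exhibits an obstruction.
tutte-acc : ∀ {n} → Even n → (H : Graph n) → Acc _<_ (nonEdges H) → ObstructionFree H → PerfectMatching H
tutte-acc ev H (acc smaller) free = step (cliqueViolation? H) (nonEdge? H)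
  where
  extend : ∀ a c a≢c → adj H a c ≡ false → PerfectMatching (addEdge H a c a≢c)
  extend a c a≢c ¬ac = tutte-acc ev (addEdge H a c a≢c) (smaller (nonEdges-addEdge H a c a≢c ¬ac))
    (λ H′ H+ac⊆H′ → free H′ (λ x y xy → H+ac⊆H′ x y (⊆addEdge H a c a≢c x y xy)))

  using-new-edge : ∀ a c a≢c → adj H a c ≡ false →
    PerfectMatching H ⊎ (Σ (PerfectMatching (addEdge H a c a≢c)) λ M → PerfectMatching.partner M a ≡ c)
  using-new-edge a c a≢c ¬ac with extend a c a≢c ¬ac
  ... | M with PerfectMatching.partner M a ≟ c
  ...   | yes pa≡c = inj₂ (M , pa≡c)
  ...   | no  pa≢c = inj₁ (restrict H a c a≢c M pa≢c)

  step : Dec (CliqueViolation H) → Dec (NonEdge H) → PerfectMatching H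
  step (yes (a , b , c , ¬Ub , ab , bc , a≢c , ¬ac)) _
    with ¬universal⇒non-neighbour H ¬Ub
  ... | d , d≢b , ¬bd with using-new-edge a c a≢c ¬ac | using-new-edge b d (d≢b ∘ sym) ¬bd
  ...   | inj₁ M         | _              = M
  ...   | inj₂ _         | inj₁ M         = M
  ...   | inj₂ (M₁ , p₁) | inj₂ (M₂ , p₂) = AlternatingWalk.perfectMatching H ab bc a≢c (d≢b ∘ sym) ¬bd M₁ M₂ p₁ p₂
  step (no _) (no ¬nonEdge) = perfectMatching-complete ev H λ x y x≢y → ¬-not λ ¬xy → ¬nonEdge (x , y , x≢y , ¬xy)
  step (no ¬violation) (yes (x , y , x≢y , ¬xy)) with using-new-edge x y x≢y ¬xy
  ... | inj₁ M         = M
  ... | inj₂ (M , pxy) with CliqueCase.perfectMatching-or-obstruction H cliques x≢y ¬xy M pxy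
    where
    cliques : CliqueNeighbourhoods H
    cliques a b c ¬Ub ab bc a≢c = ¬-not λ ¬ac → ¬violation (a , b , c , ¬Ub , ab , bc , a≢c , ¬ac)
  ...   | inj₁ M′ = M′
  ...   | inj₂ O  = ⊥-elim (free H (λ _ _ xy → xy) O)

tutte : ∀ {n} → Even n → (H : Graph n) → ObstructionFree H → PerfectMatching H
tutte ev H = tutte-acc ev H (<-wellFounded (nonEdges H))

-- Edge-disjoint matchings

Avoids : ∀ {n} → EdgeSet n → EdgeSet n → Set
Avoids M F = ∀ x y → M x y ≡ true → F x y ≡ false

pullback : ∀ {n m} → (Fin n → Fin m) → (Fin m → Fin m) → EdgeSet n
pullback ι p x y = p (ι x) == ι y

module _ {n m} {H′ : Graph m} (M : PerfectMatching H′) {ι : Fin n → Fin m} (ι-injective : ∀ {x y} → ι x ≡ ι y → x ≡ y) where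
  open PerfectMatching M

  pullback⁻ : ∀ {x y} → pullback ι partner x y ≡ true → partner (ι x) ≡ ι y
  pullback⁻ {x} {y} = ==⇒≡ {x = partner (ι x)} {ι y}

  pullback-edge : ∀ {x y} → pullback ι partner x y ≡ true → adj H′ (ι x) (ι y) ≡ true
  pullback-edge {x} Mxy = subst (λ v → adj H′ (ι x) v ≡ true) (pullback⁻ Mxy) (partner-adj (ι x))

  pullback-isMatching : (G : Graph n) → (∀ x y → adj H′ (ι x) (ι y) ≡ true → adj G x y ≡ true) →
    IsMatching G (pullback ι partner)
  pullback-isMatching G H′⇒G = record
    { inG       = λ x y Mxy → H′⇒G x y (pullback-edge Mxy)
    ; symm      = λ x y → does-⇔ (mk⇔ partner-flip partner-flip) (partner (ι x) ≟ ι y) (partner (ι y) ≟ ι x)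
    ; atMostOne = λ x y z Mxy Mxz → ι-injective (trans (sym (pullback⁻ Mxy)) (pullback⁻ Mxz))
    }

removeEdges : ∀ {n} (G : Graph n) (F : Fin n → Fin n → Bool) → (∀ x y → F x y ≡ F y x) → Graph n
removeEdges G F F-sym = record
  { adj    = λ x y → adj G x y ∧ not (F x y)
  ; sym    = λ x y → cong₂ _∧_ (adj-sym G x y) (cong not (F-sym x y))
  ; irrefl = λ x → cong (_∧ not (F x x)) (adj-irrefl G x)
  }

addUniversal : ∀ {n} → Graph n → Graph (suc n)
addUniversal {n} H = record { adj = adj′ ; sym = sym′ ; irrefl = irrefl′ }
  where
  adj′ : Fin (suc n) → Fin (suc n) → Bool
  adj′ zero    zero    = false
  adj′ zero    (suc _) = true
  adj′ (suc _) zero    = true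
  adj′ (suc x) (suc y) = adj H x y
  sym′ : ∀ x y → adj′ x y ≡ adj′ y x
  sym′ zero    zero    = refl
  sym′ zero    (suc _) = refl
  sym′ (suc _) zero    = refl
  sym′ (suc x) (suc y) = adj-sym H x y
  irrefl′ : ∀ x → adj′ x x ≡ false
  irrefl′ zero    = refl
  irrefl′ (suc x) = adj-irrefl H x

degreeIn-along : ∀ {n m} (G : Graph n) (F : Fin n → Fin n → Bool) (H′ : Graph m) (ι : Fin n → Fin m) →
  (∀ x y → adj G x y ≡ true → F x y ≡ true ⊎ adj H′ (ι x) (ι y) ≡ true) →
  (S : Fin m → Bool) → ∀ y → degreeIn G (S ∘ ι) y ≤ count (λ z → adj H′ (ι y) (ι z) ∧ S (ι z)) + count (F y)
degreeIn-along G F H′ ι G⊆F∪H′ S y = ≤-trans (count-mono in-H′-or-F) (count-∨-≤ _ (F y))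
  where
  in-H′-or-F : ∀ z → adj G y z ∧ S (ι z) ≡ true → (adj H′ (ι y) (ι z) ∧ S (ι z)) ∨ F y z ≡ true
  in-H′-or-F z yz∧Sz with G⊆F∪H′ y z (∧-conicalˡ (adj G y z) _ yz∧Sz)
  ... | inj₁ Fyz  = ∨-trueʳ (adj H′ (ι y) (ι z) ∧ S (ι z)) Fyz
  ... | inj₂ H′yz = cong (_∨ F y z) (cong₂ _∧_ H′yz (∧-conicalʳ (adj G y z) _ yz∧Sz))

module Deletion {n j} (G : Graph n) (β : OneLeβ (suc (suc j)) G)
  (F : Fin n → Fin n → Bool) (F-sym : ∀ x y → F x y ≡ F y x) (ΔF≤j : ∀ x → count (F x) ≤ j) where

  G−F : Graph n
  G−F = removeEdges G F F-sym

  G⊆F∪G−F : ∀ x y → adj G x y ≡ true → F x y ≡ true ⊎ adj G−F x y ≡ true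
  G⊆F∪G−F x y xy with true-or-false (F x y)
  ... | inj₁ Fxy  = inj₁ Fxy
  ... | inj₂ ¬Fxy = inj₂ (cong₂ _∧_ xy (cong not ¬Fxy))

  G−F-obstructionFree : ObstructionFree G−F
  G−F-obstructionFree H′ G−F⊆H′ O = β⇒¬Deficient G β F ΔF≤j record
    { s = S ; c = C ; u = universal H′ ; x₀ = x₀ ; y₀ = y₀ ; x₀∈c = x₀∈C
    ; N[x₀]⊆F∪c∪u = λ z x₀z → map₂ (N[x₀]⊆C∪U z) (G⊆F∪H′ x₀ z x₀z)
    ; sparse-outside = λ z ¬Cz ¬Uz → s≤s (≤-trans (degreeIn-along G F H′ id G⊆F∪H′ S z)
                                                    (+-mono-≤ (sparse-outside z ¬Uz ¬Cz) (ΔF≤j z)))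
    ; y₀∈s = y₀∈S ; y₀∉c = y₀∉C ; y₀∉u = S⊆non-universal y₀ y₀∈S ; c+u<s = C+U<S
    }
    where
    open Obstruction O
    G⊆F∪H′ : ∀ x y → adj G x y ≡ true → F x y ≡ true ⊎ adj H′ x y ≡ true
    G⊆F∪H′ x y xy = map₂ (G−F⊆H′ x y) (G⊆F∪G−F x y xy)

  G−F+v : Graph (suc n)
  G−F+v = addUniversal G−F

  G−F+v-obstructionFree : ObstructionFree G−F+v
  G−F+v-obstructionFree H′ ⊆H′ O = restrict-to-G x₀ y₀ x₀∈C y₀∈S y₀∉C N[x₀]⊆C∪U
    where
    open Obstruction O
    U : Fin (suc n) → Bool
    U = universal H′
    U0 : U zero ≡ true
    U0 = dec-true (universal? H′ zero) zero-adj
      where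
      zero-adj : ∀ w → w ≡ zero ⊎ adj H′ zero w ≡ true
      zero-adj zero    = inj₁ refl
      zero-adj (suc w) = inj₂ (⊆H′ zero (suc w) refl)
    S0 : S zero ≡ false
    S0 = ¬-not λ S0 → not-¬ U0 (S⊆non-universal zero S0)
    C0 : C zero ≡ false
    C0 = ¬-not λ C0 → not-¬ (C⊆S zero C0) S0
    c+u<s : count (C ∘ suc) + count (U ∘ suc) < count (S ∘ suc)
    c+u<s = begin-strict
      count (C ∘ suc) + count (U ∘ suc)        <⟨ +-mono-≤-< (m≤n+m _ (bool→ℕ (C zero))) (n<1+n _) ⟩
      count C + suc (count (U ∘ suc))          ≡⟨ cong (λ b → count C + (bool→ℕ b + count (U ∘ suc))) U0 ⟨
      count C + count U                        <⟨ C+U<S ⟩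
      count S                                  ≡⟨ cong (λ b → bool→ℕ b + count (S ∘ suc)) S0 ⟩
      count (S ∘ suc)                          ∎
      where open ≤-Reasoning
    G⊆F∪H′ : ∀ x y → adj G x y ≡ true → F x y ≡ true ⊎ adj H′ (suc x) (suc y) ≡ true
    G⊆F∪H′ x y xy = map₂ (⊆H′ (suc x) (suc y)) (G⊆F∪G−F x y xy)
    restrict-to-G : ∀ x y → C x ≡ true → S y ≡ true → C y ≡ false →
      (∀ z → adj H′ x z ≡ true → C z ≡ true ⊎ U z ≡ true) → ⊥
    restrict-to-G zero    _       Cx _  _   _    = not-¬ Cx C0
    restrict-to-G (suc _) zero    _  Sy _   _    = not-¬ Sy S0
    restrict-to-G (suc x) (suc y) Cx Sy ¬Cy N[x] = β⇒¬Deficient G β F ΔF≤j record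
      { s = S ∘ suc ; c = C ∘ suc ; u = U ∘ suc ; x₀ = x ; y₀ = y ; x₀∈c = Cx
      ; N[x₀]⊆F∪c∪u = λ z xz → map₂ (N[x] (suc z)) (G⊆F∪H′ x z xz)
      ; sparse-outside = λ z ¬Cz ¬Uz → s≤s (≤-trans (degreeIn-along G F H′ suc G⊆F∪H′ S z)
          (+-mono-≤ (≤-trans (m≤n+m _ (bool→ℕ (adj H′ (suc z) zero ∧ S zero))) (sparse-outside (suc z) ¬Uz ¬Cz)) (ΔF≤j z)))
      ; y₀∈s = Sy ; y₀∉c = ¬Cy ; y₀∉u = S⊆non-universal (suc y) Sy ; c+u<s = c+u<s
      }

  G−F⇒G : ∀ x y → adj G−F x y ≡ true → adj G x y ≡ true
  G−F⇒G x y xy = ∧-conicalˡ (adj G x y) _ xy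

  G−F-avoids : ∀ {x y} → adj G−F x y ≡ true → F x y ≡ false
  G−F-avoids {x} {y} xy = not-injective (∧-conicalʳ (adj G x y) _ xy)

  perfectMatching-avoiding : Even n → Σ (EdgeSet n) λ M → IsPerfectMatching G M × Avoids M F
  perfectMatching-avoiding ev =
    pullback id partner ,
    (pullback-isMatching M id G G−F⇒G , λ v → partner v , ==-refl (partner v)) ,
    (λ x y Mxy → G−F-avoids (pullback-edge M id Mxy))
    where
    M : PerfectMatching G−F
    M = tutte ev G−F G−F-obstructionFree
    open PerfectMatching M

  -- The vertex matched to the added universal vertex is the uncovered one.
  nearPerfectMatching-avoiding : Even (suc n) → Σ (EdgeSet n) λ M → IsNearPerfectMatching G M × Avoids M F
  nearPerfectMatching-avoiding ev =
    pullback suc partner ,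
    (pullback-isMatching M suc-injective G G−F⇒G , one-uncovered) ,
    (λ x y Mxy → G−F-avoids (pullback-edge M suc-injective Mxy))
    where
    M : PerfectMatching G−F+v
    M = tutte ev G−F+v G−F+v-obstructionFree
    open PerfectMatching M
    one-uncovered : ∃ λ x → ¬ Covered (pullback suc partner) x × (∀ v → v ≢ x → Covered (pullback suc partner) v)
    one-uncovered with partner zero in p0
    ... | zero  = ⊥-elim (partner-≢ zero p0)
    ... | suc x = x , uncovered , covered
      where
      uncovered : ¬ Covered (pullback suc partner) x
      uncovered (u , Mxu) with trans (sym (partner-flip p0)) (pullback⁻ M suc-injective Mxu)
      ... | ()
      covered : ∀ v → v ≢ x → Covered (pullback suc partner) v
      covered v v≢x with partner (suc v) in pv
      ... | zero  = ⊥-elim (v≢x (suc-injective (trans (sym (partner-flip pv)) p0)))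
      ... | suc u = u , ==-refl (suc u)

union : ∀ {i n} → (Fin i → EdgeSet n) → EdgeSet n
union {zero}  Ms x y = false
union {suc i} Ms x y = Ms zero x y ∨ union (Ms ∘ suc) x y

union⁺ : ∀ {i n} (Ms : Fin i → EdgeSet n) l {x y} → Ms l x y ≡ true → union Ms x y ≡ true
union⁺ Ms zero    {x} {y} Mxy = cong (_∨ union (Ms ∘ suc) x y) Mxy
union⁺ Ms (suc l) {x} {y} Mxy = ∨-trueʳ (Ms zero x y) (union⁺ (Ms ∘ suc) l Mxy)

union-sym : ∀ {i n} (Ms : Fin i → EdgeSet n) → (∀ l x y → Ms l x y ≡ Ms l y x) → ∀ x y → union Ms x y ≡ union Ms y x
union-sym {zero}  Ms Ms-sym x y = refl
union-sym {suc i} Ms Ms-sym x y = cong₂ _∨_ (Ms-sym zero x y) (union-sym (Ms ∘ suc) (Ms-sym ∘ suc) x y)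

count-union : ∀ {i n} (Ms : Fin i → EdgeSet n) x → (∀ l → count (Ms l x) ≤ 1) → count (union Ms x) ≤ i
count-union {zero}  {n} Ms x _  = ≤-reflexive (count-false {n} (λ _ → false) (λ _ → refl))
count-union {suc i}     Ms x ≤1 = ≤-trans (count-∨-≤ (Ms zero x) (union (Ms ∘ suc) x)) (+-mono-≤ (≤1 zero) (count-union (Ms ∘ suc) x (≤1 ∘ suc)))

module Greedy {n j} (G : Graph n) (Q : EdgeSet n → Set) (Q⇒matching : ∀ M → Q M → IsMatching G M)
  (avoiding : (F : EdgeSet n) → (∀ x y → F x y ≡ F y x) → (∀ x → count (F x) ≤ j) → Σ (EdgeSet n) λ M → Q M × Avoids M F) where

  disjointFamily : ∀ i → i ≤ suc j → Σ (Fin i → EdgeSet n) λ Ms → (∀ l → Q (Ms l)) × PairwiseEdgeDisjoint Ms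
  disjointFamily zero    _        = (λ ()) , (λ ()) , (λ ())
  disjointFamily (suc i) 1+i≤1+j  with disjointFamily i (m≤n⇒m≤1+n (≤-pred 1+i≤1+j))
  ... | Ms , Q-Ms , disjoint = Ms′ , Q-Ms′ , disjoint′
    where
    matching : ∀ l → IsMatching G (Ms l)
    matching l = Q⇒matching (Ms l) (Q-Ms l)
    next : Σ (EdgeSet n) λ M → Q M × Avoids M (union Ms)
    next = avoiding (union Ms) (union-sym Ms (IsMatching.symm ∘ matching))
      (λ x → ≤-trans (count-union Ms x (λ l → count-≤1 (Ms l x) (IsMatching.atMostOne (matching l) x))) (≤-pred 1+i≤1+j))
    Ms′ : Fin (suc i) → EdgeSet n
    Ms′ zero    = proj₁ next
    Ms′ (suc l) = Ms l
    Q-Ms′ : ∀ l → Q (Ms′ l)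
    Q-Ms′ zero    = proj₁ (proj₂ next)
    Q-Ms′ (suc l) = Q-Ms l
    disjoint′ : PairwiseEdgeDisjoint Ms′
    disjoint′ zero    zero    0≢0 _ _ _                = 0≢0 refl
    disjoint′ zero    (suc l) _   u v (Muv , Mluv)    = not-¬ (union⁺ Ms l Mluv) (proj₂ (proj₂ next) u v Muv)
    disjoint′ (suc l) zero    _   u v (Mluv , Muv)    = not-¬ (union⁺ Ms l Mluv) (proj₂ (proj₂ next) u v Muv)
    disjoint′ (suc l) (suc m) l≢m u v                  = disjoint l m (l≢m ∘ cong suc) u v

%2≡0⇒Even : ∀ n → n % 2 ≡ 0 → Even n
%2≡0⇒Even zero          _  = even-zero
%2≡0⇒Even (suc (suc n)) eq = even-2+ (%2≡0⇒Even n eq)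

%2≡1⇒Even-suc : ∀ n → n % 2 ≡ 1 → Even (suc n)
%2≡1⇒Even-suc (suc zero)    _  = even-2+ even-zero
%2≡1⇒Even-suc (suc (suc n)) eq = even-2+ (%2≡1⇒Even-suc n eq)

theorem1p3 : (k n : ℕ) → 1 ≤ k → (G : Graph n) → OneLeβ k G →
    (n % 2 ≡ 0 → Σ (Fin (k ∸ 1) → EdgeSet n) λ Ms →
        ((i : Fin (k ∸ 1)) → IsPerfectMatching G (Ms i)) × PairwiseEdgeDisjoint Ms)
    × (n % 2 ≡ 1 → Σ (Fin (k ∸ 1) → EdgeSet n) λ Ms →
        ((i : Fin (k ∸ 1)) → IsNearPerfectMatching G (Ms i)) × PairwiseEdgeDisjoint Ms)
theorem1p3 (suc zero)    n _ G β = (λ _ → (λ ()) , (λ ()) , (λ ())) , (λ _ → (λ ()) , (λ ()) , (λ ()))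
theorem1p3 (suc (suc j)) n _ G β =
  (λ n-even → Greedy.disjointFamily G (IsPerfectMatching G) (λ _ → proj₁)
     (λ F F-sym ΔF≤j → Deletion.perfectMatching-avoiding G β F F-sym ΔF≤j (%2≡0⇒Even n n-even)) (suc j) ≤-refl) ,
  (λ n-odd → Greedy.disjointFamily G (IsNearPerfectMatching G) (λ _ → proj₁)
     (λ F F-sym ΔF≤j → Deletion.nearPerfectMatching-avoiding G β F F-sym ΔF≤j (%2≡1⇒Even-suc n n-odd)) (suc j) ≤-refl)
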